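{- Let $n\ge1$ and let $\mathcal{B}=(G,\theta)$ be the valued digraph defined as follows. Its vertex set is $\lambda_n^s=\{(a,b)\in[\pm n]^2: a<b,\ |a|\le b\}$. For $(a,b)\in\lambda_n^s$ let $\widetilde H(a,b)=\{(a,b)\}\cup\{(x,y)\in\lambda_n^s:\exists k\in[\pm n],\ a<k<b,\ (x,y)\in\{(k,b),(a,k),(-k,-a)\}\}$; there is an arc from $\mathfrak{c}$ to $\mathfrak{d}$ iff $\mathfrak{c}\ne\mathfrak{d}$ and $\mathfrak{d}\in\widetilde H(\mathfrak{c})$; and $\theta(\mathfrak{c})=d^+(\mathfrak{c})/2$. Then $(B_n,\le_R)$ is isomorphic to $(IS(\mathcal{B}),\subseteq)$.
   Context: $[\pm n]=\{ -n,\dots,-1,1,\dots,n\}$. $B_n$ is the Coxeter group with generators $s_0,s_1,\dots,s_{n-1}$, realized as the group of signed permutations $\omega$ of $[\pm n]$ (bijections with $\omega(-m)=-\omega(m)$), where $s_0$ exchanges $1$ and $-1$ and $s_i$ ($i\ge1$) exchanges $i,i+1$ (and $-i,-i-1$). With $\ell$ the Coxeter length, the right weak order is $w\le_R\tau$ iff $\tau=ws_{j_1}\cdots s_{j_k}$ with $\ell(\tau)=\ell(w)+k$. Valued digraph: pair $(G,\theta)$, $G=(V,E)$ simple acyclic digraph, $\theta:V\to\mathbb{N}$ with $0\le\theta(x)\le d^+(x)$ (out-degree). A vertex $x$ is erasable if $\theta(x)=0$ and every $z$ with $(z,x)\in E$ has $\theta(z)\ne0$. Peeling process: repeatedly choose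 an erasable vertex $x_i$ of the current valued digraph, delete it with its incident arcs, and decrease by $1$ the value of each $y$ with an arc $(y,x_i)$; stop when no erasable vertex remains. $IS(\mathcal{G})$ consists of $\emptyset$ and all sets $\{x_1,\dots,x_k\}$ ($k\ge1$) formed by the first $k$ entries of a peeling sequence. -}

module Defs where

open import Data.Bool using (Bool; true; false; not; _∧_; _∨_; if_then_else_)
open import Data.Nat using (ℕ; zero; suc; _∸_; _≤_; _+_; ⌊_/2⌋)
open import Data.Fin using (Fin; zero; suc; inject₁; toℕ)
open import Data.Fin.Properties using () renaming (_≟_ to _≟F_)
open import Data.Integer using (ℤ; +_; -[1+_]; ∣_∣) renaming (_<_ to _<ℤ_; _≤_ to _≤ℤ_)
open import Data.Integer.Properties using () renaming (_<?_ to _<ℤ?_; _≤?_ to _≤ℤ?_)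
open import Data.List using (List; []; _∷_; _∷ʳ_; length; take; concatMap; map)
open import Data.Bool.ListAction using (any)
open import Data.List.Membership.Propositional using (_∈_; _∉_)
open import Data.List.Relation.Binary.Subset.Propositional using (_⊆_)
open import Data.Product using (Σ; ∃; _×_; _,_)
open import Data.Sum using (_⊎_)
open import Data.Vec.Functional using ()
open import Data.Fin using (Fin)
import Data.Fin as F
open import Data.List using (allFin) renaming (filter to lfilter)
open import Relation.Nullary using (¬_; does)
open import Relation.Binary.PropositionalEquality using (_≡_; _≢_)
open import Data.Product.Properties using (≡-dec)
import Data.Bool.Properties as BP
open import Function using (_∘_; id; _⇔_)

-- The set [±n] = {-n,…,-1,1,…,n}.
-- (true , i) stands for +(i+1) and (false , i) for -(i+1).

PM : ℕ → Set
PM n = Bool × Fin n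

toℤ : ∀ {n} → PM n → ℤ
toℤ (true  , i) = + suc (toℕ i)
toℤ (false , i) = -[1+ toℕ i ]

neg : ∀ {n} → PM n → PM n
neg (s , i) = (not s , i)

_==PM_ : ∀ {n} → PM n → PM n → Bool
x ==PM y = does (≡-dec BP._≟_ _≟F_ x y)

allPM : (n : ℕ) → List (PM n)
allPM n = map (true ,_) (allFin n) Data.List.++ map (false ,_) (allFin n)

record SignedPerm (n : ℕ) : Set where
  field
    fun   : PM n → PM n
    inv   : PM n → PM n
    invˡ  : ∀ x → inv (fun x) ≡ x
    invʳ  : ∀ x → fun (inv x) ≡ x
    odd   : ∀ x → fun (neg x) ≡ neg (fun x)
open SignedPerm public

_≈B_ : ∀ {n} → SignedPerm n → SignedPerm n → Set
w ≈B τ = ∀ x → fun w x ≡ fun τ x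

-- The Coxeter generators s_0,…,s_{n-1} (indexed by Fin n), as maps on [±n]:
-- s_0 exchanges 1 and -1; s_i (i ≥ 1) exchanges i,i+1 and -i,-i-1.

swapF : ∀ {n} → Fin n → Fin n → Fin n → Fin n
swapF a b i = if does (i ≟F a) then b else (if does (i ≟F b) then a else i)

gen : ∀ {n} → Fin n → PM n → PM n
gen {suc m} zero    (s , zero)  = (not s , zero)
gen {suc m} zero    (s , suc i) = (s , suc i)
gen {suc m} (suc j) (s , i)     = (s , swapF (inject₁ j) (suc j) i)

word : ∀ {n} → List (Fin n) → PM n → PM n
word []       = id
word (j ∷ js) = gen j ∘ word js

Represents : ∀ {n} → List (Fin n) → SignedPerm n → Set
Represents js w = ∀ x → word js x ≡ fun w x

HasLength : ∀ {n} → SignedPerm n → ℕ → Set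
HasLength w k =
  (Σ (List _) λ js → length js ≡ k × Represents js w)
  × (∀ js → Represents js w → k ≤ length js)

_≤R_ : ∀ {n} → SignedPerm n → SignedPerm n → Set
_≤R_ {n} w τ = Σ (List (Fin n)) λ js →
  (∀ x → fun τ x ≡ fun w (word js x))
  × Σ ℕ λ k → HasLength w k × HasLength τ (k + length js)

module Peeling {V : Set} (verts : List V) (arc : V → V → Bool) (θ : V → ℕ) where

  cnt : V → List V → ℕ
  cnt y []      = 0
  cnt y (x ∷ R) = if arc y x then suc (cnt y R) else cnt y R

  value : List V → V → ℕ
  value R y = θ y ∸ cnt y R

  Erasable : List V → V → Set
  Erasable R x =
    x ∈ verts × x ∉ R × value R x ≡ 0
    × (∀ z → z ∈ verts → z ∉ R → arc z x ≡ true → value R z ≢ 0)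

  data Peel : List V → Set where
    done : Peel []
    step : ∀ {R x} → Peel R → Erasable R x → Peel (R ∷ʳ x)

  Complete : List V → Set
  Complete xs = Peel xs × (∀ x → ¬ Erasable xs x)

  _≋_ : List V → List V → Set
  X ≋ Y = X ⊆ Y × Y ⊆ X

  InIS : List V → Set
  InIS X = (∀ x → x ∉ X)
         ⊎ Σ (List V) λ xs → Σ ℕ λ k →
             Complete xs × 1 ≤ k × k ≤ length xs × X ≋ take k xs

VB : ℕ → Set
VB n = PM n × PM n

_<B_ : ℤ → ℤ → Bool
a <B b = does (a <ℤ? b)

_==V_ : ∀ {n} → VB n → VB n → Bool
(a , b) ==V (c , d) = (a ==PM c) ∧ (b ==PM d)

inλ : ∀ {n} → VB n → Bool
inλ (a , b) = (toℤ a <B toℤ b) ∧ does (+ ∣ toℤ a ∣ ≤ℤ? toℤ b)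

λs : (n : ℕ) → List (VB n)
λs n = lfilter (λ v → BP.T? (inλ v)) (concatMap (λ a → map (a ,_) (allPM n)) (allPM n))

arcB : ∀ {n} → VB n → VB n → Bool
arcB {n} (a , b) d =
  inλ (a , b) ∧ inλ d ∧ not (d ==V (a , b))
  ∧ any (λ k → (toℤ a <B toℤ k) ∧ (toℤ k <B toℤ b)
               ∧ ((d ==V (k , b)) ∨ (d ==V (a , k)) ∨ (d ==V (neg k , neg a))))
        (allPM n)

outdeg : ∀ {n} → VB n → ℕ
outdeg {n} c = length (lfilter (λ d → BP.T? (arcB c d)) (λs n))

θB : ∀ {n} → VB n → ℕ
θB c = ⌊ outdeg c /2⌋

module 𝓑 (n : ℕ) = Peeling (λs n) (arcB {n}) (θB {n})

module Submission where

-- The isomorphism is the inversion set Φ(w) = { (a,b) ∈ λ_n^s : w⁻¹(b) < w⁻¹(a) }.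
-- Every pair of distinct values x ≠ y of [±n] is represented by exactly one
-- vertex of λ_n^s (up to swapping and negating), which lets us attach to each
-- generator s_j the vertex E(w,j) representing {w(e_j), w(f_j)}, where s_j
-- exchanges the adjacent values e_j < f_j.  The proof has three parts.
--   (1) Coxeter combinatorics: Φ(w s_j) = Φ(w) ± E(w,j) (the "flip" lemma);
--       Φ determines w; ℓ(w) = |Φ(w)|; and w ≤_R τ ⇔ Φ(w) ⊆ Φ(τ).
--   (2) Values during peeling: the out-neighbours of a vertex c = (a,b) come
--       in partner pairs {(k,b), lower(c,k)} for a < k < b, so θ(c) = #pairs.
--       When exactly Φ(w) has been peeled, counting the removed neighbours
--       pair by pair shows that c is erasable iff w⁻¹ maps a, b to adjacent
--       values in increasing order, i.e. iff c = E(w,j) for an ascent s_j.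
--   (3) Hence peeling sequences are exactly the inversion sequences of reduced
--       words, so IS(𝓑) = { Φ(w) }, and Theorem 5 follows from (1).

open import Defs

open import Data.Bool using (Bool; true; false; not; _∧_; _∨_; if_then_else_; T)
open import Data.Bool.ListAction using (any)
import Data.Bool.Properties as BoolP
open import Data.Empty using (⊥; ⊥-elim)
open import Data.Fin using (Fin; zero; suc; toℕ; inject₁; fromℕ<)
open import Data.Fin.Properties
  using (toℕ-injective; toℕ-inject₁; toℕ-fromℕ<; toℕ<n; any?) renaming (_≟_ to _≟F_)
open import Data.Integer using (∣_∣; -_; -≤+; +<+; -<-; -<+)
  renaming (+_ to ℤ+_; _<_ to _<ℤ_; _≤_ to _≤ℤ_)
import Data.Integer.Properties as ℤP
open import Data.List
  using (List; []; _∷_; _++_; _∷ʳ_; length; map; concatMap; allFin; take; filter)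
import Data.List.Properties as ListP
open import Data.List.Membership.Propositional using (_∈_; _∉_)
open import Data.List.Membership.Propositional.Properties
  using (∈-++⁺ˡ; ∈-++⁺ʳ; ∈-++⁻; ∈-map⁺; ∈-map⁻; ∈-filter⁺; ∈-filter⁻; ∈-allFin;
         ∈-concatMap⁺; ∈-concatMap⁻; ∉[])
open import Data.List.Relation.Binary.Subset.Propositional using (_⊆_)
open import Data.List.Relation.Unary.All using (All; []; _∷_)
import Data.List.Relation.Unary.All as AllP
open import Data.List.Relation.Unary.Any using (Any; here; there)
import Data.List.Relation.Unary.Any as Any
open import Data.List.Relation.Unary.AllPairs using ([]; _∷_)
open import Data.List.Relation.Unary.Unique.Propositional using (Unique)
import Data.List.Relation.Unary.Unique.Propositional.Properties as UniqueP
open import Data.Nat using (ℕ; zero; suc; _+_; _∸_; _≤_; _<_; z≤n; s≤s; ⌊_/2⌋)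
import Data.Nat.Properties as ℕP
open import Data.Product using (Σ; _×_; _,_; proj₁; proj₂)
open import Data.Product.Properties using (≡-dec)
open import Data.Sum using (_⊎_; inj₁; inj₂; [_,_]′)
open import Function using (_∘_; id; _⇔_; mk⇔)
open import Relation.Binary using (tri<; tri≈; tri>)
open import Relation.Binary.PropositionalEquality
  using (_≡_; _≢_; refl; sym; trans; cong; cong₂; subst; subst₂)
open import Relation.Nullary using (¬_; Dec; yes; no; does)
open import Relation.Nullary.Decidable using (dec-true; dec-false; _×-dec_; toSum)

private variable
  A B : Set
  n : ℕ

remove : ∀ {x : A} (ys : List A) → x ∈ ys → List A
remove (y ∷ ys) (here _)  = ys
remove (y ∷ ys) (there p) = y ∷ remove ys p

length-remove : ∀ {x : A} (ys : List A) (p : x ∈ ys) → length ys ≡ suc (length (remove ys p))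
length-remove (y ∷ ys) (here _)  = refl
length-remove (y ∷ ys) (there p) = cong suc (length-remove ys p)

∈-remove : ∀ {x z : A} (ys : List A) (p : x ∈ ys) → z ∈ ys → z ≢ x → z ∈ remove ys p
∈-remove (y ∷ ys) (here refl) (here refl) z≢x = ⊥-elim (z≢x refl)
∈-remove (y ∷ ys) (here refl) (there q)   z≢x = q
∈-remove (y ∷ ys) (there p)   (here refl) z≢x = here refl
∈-remove (y ∷ ys) (there p)   (there q)   z≢x = there (∈-remove ys p q z≢x)

All≢⇒∉ : ∀ {x : A} {xs} → All (x ≢_) xs → x ∉ xs
All≢⇒∉ (x≢y ∷ _)  (here refl) = x≢y refl
All≢⇒∉ (_   ∷ ps) (there p)   = All≢⇒∉ ps p

∉⇒All≢ : ∀ {x : A} {xs} → x ∉ xs → All (x ≢_) xs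
∉⇒All≢ {xs = []}     _   = []
∉⇒All≢ {xs = y ∷ xs} x∉ = (λ e → x∉ (here e)) ∷ ∉⇒All≢ (x∉ ∘ there)

unique-⊆-length : ∀ {xs ys : List A} → Unique xs → xs ⊆ ys → length xs ≤ length ys
unique-⊆-length {xs = []}     _          _   = z≤n
unique-⊆-length {xs = x ∷ xs} {ys} (x∉ ∷ u) sub =
  subst (suc (length xs) ≤_) (sym (length-remove ys x∈ys))
    (s≤s (unique-⊆-length u (λ z∈ → ∈-remove ys x∈ys (sub (there z∈))
                                (λ { refl → All≢⇒∉ x∉ z∈ }))))
  where x∈ys : x ∈ ys
        x∈ys = sub (here refl)

unique-∷ : ∀ {x : A} {xs} → x ∉ xs → Unique xs → Unique (x ∷ xs)
unique-∷ x∉ u = ∉⇒All≢ x∉ ∷ u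

unique-∷ʳ : ∀ {x : A} (xs : List A) → x ∉ xs → Unique xs → Unique (xs ∷ʳ x)
unique-∷ʳ {x = x} xs x∉ u = UniqueP.++⁺ u ([] ∷ []) disjoint
  where
  disjoint : ∀ {z} → z ∈ xs × z ∈ x ∷ [] → ⊥
  disjoint (z∈ , here refl) = x∉ z∈

length-double : ∀ (xs : List A) (f : A → A) → length (xs ++ map f xs) ≡ length xs + length xs
length-double xs f = trans (ListP.length-++ xs) (cong (length xs +_) (ListP.length-map f xs))

unique-map : ∀ (f : A → B) (xs : List A) → (∀ {x y} → x ∈ xs → y ∈ xs → f x ≡ f y → x ≡ y) →
             Unique xs → Unique (map f xs)
unique-map f []       _   _        = []
unique-map f (x ∷ xs) inj (x∉ ∷ u) =
  ∉⇒All≢ (λ m → let (y , y∈ , e) = ∈-map⁻ f m in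
                All≢⇒∉ x∉ (subst (_∈ xs) (sym (inj (here refl) (there y∈) e)) y∈))
  ∷ unique-map f xs (λ p q → inj (there p) (there q)) u

-- Counting with an involution σ on a duplicate-free list L: relative to a
-- sublist G, if every element of L is in G up to σ then |L| ≤ 2|G|, and if
-- G meets each σ-pair at most once and misses some non-fixed pair
-- entirely then |L| ≥ 2|G| + 2.  These bound the values in the peeling.
module Pairing (L G : List A) (σ : A → A) (σσ : ∀ {d} → d ∈ L → σ (σ d) ≡ d) where

  pairing-lower : Unique L → (∀ {d} → d ∈ L → d ∈ G ⊎ σ d ∈ G) →
                  length L ≤ length G + length G
  pairing-lower uL covered =
    subst (length L ≤_) (length-double G σ) (unique-⊆-length uL L⊆)
    where
    L⊆ : L ⊆ G ++ map σ G
    L⊆ {d} d∈ with covered d∈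
    ... | inj₁ g = ∈-++⁺ˡ g
    ... | inj₂ g = ∈-++⁺ʳ G (subst (_∈ map σ G) (σσ d∈) (∈-map⁺ σ g))

  pairing-upper : Unique G → G ⊆ L → (∀ {d} → d ∈ L → σ d ∈ L) →
                  (∀ {d} → d ∈ G → σ d ∉ G) →
                  ∀ d₀ → d₀ ∈ L → d₀ ∉ G → σ d₀ ∉ G → σ d₀ ≢ d₀ →
                  suc (suc (length G + length G)) ≤ length L
  pairing-upper uG G⊆ σ-closed once d₀ d₀∈ d₀∉ σd₀∉ σd₀≢d₀ =
    subst (_≤ length L) (cong (λ m → suc (suc m)) (length-double G σ)) (unique-⊆-length U S)
    where
    σ-injective : ∀ {x y} → x ∈ G → y ∈ G → σ x ≡ σ y → x ≡ y
    σ-injective x∈ y∈ e = trans (sym (σσ (G⊆ x∈))) (trans (cong σ e) (σσ (G⊆ y∈)))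
    ∈-image : ∀ {x} → x ∈ L → x ∈ map σ G → σ x ∈ G
    ∈-image x∈L m with ∈-map⁻ σ m
    ... | y , y∈ , refl = subst (_∈ G) (sym (σσ (G⊆ y∈))) y∈
    G+σG : List A
    G+σG = G ++ map σ G
    U-G+σG : Unique G+σG
    U-G+σG = UniqueP.++⁺ uG (unique-map σ G σ-injective uG)
               (λ { (z∈ , m) → once z∈ (∈-image (G⊆ z∈) m) })
    σd₀∉G+σG : σ d₀ ∉ G+σG
    σd₀∉G+σG m with ∈-++⁻ G m
    ... | inj₁ g = σd₀∉ g
    ... | inj₂ g = d₀∉ (subst (_∈ G) (σσ d₀∈) (∈-image (σ-closed d₀∈) g))
    d₀∉rest : d₀ ∉ σ d₀ ∷ G+σG
    d₀∉rest (here e) = σd₀≢d₀ (sym e)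
    d₀∉rest (there m) with ∈-++⁻ G m
    ... | inj₁ g = d₀∉ g
    ... | inj₂ g = σd₀∉ (∈-image d₀∈ g)
    U : Unique (d₀ ∷ σ d₀ ∷ G+σG)
    U = unique-∷ d₀∉rest (unique-∷ σd₀∉G+σG U-G+σG)
    S : (d₀ ∷ σ d₀ ∷ G+σG) ⊆ L
    S (here refl)         = d₀∈
    S (there (here refl)) = σ-closed d₀∈
    S (there (there m)) with ∈-++⁻ G m
    ... | inj₁ g = G⊆ g
    ... | inj₂ g with ∈-map⁻ σ g
    ... | y , y∈ , refl = σ-closed (G⊆ y∈)

∧-elim : ∀ {a b} → a ∧ b ≡ true → a ≡ true × b ≡ true
∧-elim {true} {true} _ = refl , refl

∧-intro : ∀ {a b} → a ≡ true → b ≡ true → a ∧ b ≡ true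
∧-intro refl refl = refl

∨-elim : ∀ {a b} → a ∨ b ≡ true → a ≡ true ⊎ b ≡ true
∨-elim {true}  _ = inj₁ refl
∨-elim {false} e = inj₂ e

∨-introˡ : ∀ {a b} → a ≡ true → a ∨ b ≡ true
∨-introˡ refl = refl

∨-introʳ : ∀ a {b} → b ≡ true → a ∨ b ≡ true
∨-introʳ true  _ = refl
∨-introʳ false e = e

true≢false : true ≢ false
true≢false ()

T⇒≡true : ∀ {b} → T b → b ≡ true
T⇒≡true {true} _ = refl

bool-cases : ∀ (b : Bool) → b ≡ true ⊎ b ≡ false
bool-cases true  = inj₁ refl
bool-cases false = inj₂ refl

does-true⇒ : ∀ {P : Set} (d : Dec P) → does d ≡ true → P
does-true⇒ (yes p) _ = p

does-false⇒ : ∀ {P : Set} (d : Dec P) → does d ≡ false → ¬ P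
does-false⇒ (no ¬p) _ = ¬p

any-elim : ∀ (p : A → Bool) xs → any p xs ≡ true → Σ A λ x → x ∈ xs × p x ≡ true
any-elim p (x ∷ xs) e with p x in px
... | true  = x , here refl , px
... | false = let (y , y∈ , py) = any-elim p xs e in y , there y∈ , py

any-intro : ∀ (p : A → Bool) {x} xs → x ∈ xs → p x ≡ true → any p xs ≡ true
any-intro p (y ∷ xs) (here refl) px rewrite px = refl
any-intro p (y ∷ xs) (there m)   px with p y
... | true  = refl
... | false = any-intro p xs m px

if-true : ∀ {b} {x y : A} → b ≡ true → (if b then x else y) ≡ x
if-true refl = refl

if-false : ∀ {b} {x y : A} → b ≡ false → (if b then x else y) ≡ y
if-false refl = refl

module _ {n : ℕ} where

  infix 4 _≺_ _≼_
  _≺_ _≼_ : PM n → PM n → Set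
  x ≺ y = toℤ x <ℤ toℤ y
  x ≼ y = toℤ x ≤ℤ toℤ y

  neg-involutive : ∀ (x : PM n) → neg (neg x) ≡ x
  neg-involutive (s , i) = cong (_, i) (BoolP.not-involutive s)

  toℤ-neg : ∀ (x : PM n) → toℤ (neg x) ≡ - toℤ x
  toℤ-neg (true  , i) = refl
  toℤ-neg (false , i) = refl

  toℤ-injective : ∀ {x y : PM n} → toℤ x ≡ toℤ y → x ≡ y
  toℤ-injective {true  , i} {true  , j} e =
    cong (true ,_) (toℕ-injective (ℕP.suc-injective (ℤP.+-injective e)))
  toℤ-injective {false , i} {false , j} e = cong (false ,_) (toℕ-injective (ℤP.-[1+-injective e))

  neg≢ : ∀ (x : PM n) → neg x ≢ x
  neg≢ (true  , i) ()
  neg≢ (false , i) ()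

  neg-injective : ∀ {x y : PM n} → neg x ≡ neg y → x ≡ y
  neg-injective {x} {y} e = trans (sym (neg-involutive x)) (trans (cong neg e) (neg-involutive y))

  ≺-neg : ∀ {x y : PM n} → x ≺ y → neg y ≺ neg x
  ≺-neg {x} {y} p rewrite toℤ-neg x | toℤ-neg y = ℤP.neg-mono-< p

  ≺-neg⁻ : ∀ {x y : PM n} → neg y ≺ neg x → x ≺ y
  ≺-neg⁻ {x} {y} p = subst₂≺ (neg-involutive x) (neg-involutive y) (≺-neg p)
    where subst₂≺ : ∀ {a b c d} → a ≡ c → b ≡ d → a ≺ b → c ≺ d
          subst₂≺ refl refl q = q

  ≼-neg : ∀ {x y : PM n} → x ≼ y → neg y ≼ neg x
  ≼-neg {x} {y} p rewrite toℤ-neg x | toℤ-neg y = ℤP.neg-mono-≤ p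

  ≺-trans : ∀ {x y z : PM n} → x ≺ y → y ≺ z → x ≺ z
  ≺-trans = ℤP.<-trans

  ≺-irrefl : ∀ {x : PM n} → ¬ (x ≺ x)
  ≺-irrefl = ℤP.<-irrefl refl

  ≺-asym : ∀ {x y : PM n} → x ≺ y → ¬ (y ≺ x)
  ≺-asym = ℤP.<-asym

  ≺⇒≢ : ∀ {x y : PM n} → x ≺ y → x ≢ y
  ≺⇒≢ p refl = ≺-irrefl p

  ≺-cmp : ∀ (x y : PM n) → x ≺ y ⊎ x ≡ y ⊎ y ≺ x
  ≺-cmp x y with ℤP.<-cmp (toℤ x) (toℤ y)
  ... | tri< x<y _ _ = inj₁ x<y
  ... | tri≈ _ x≡y _ = inj₂ (inj₁ (toℤ-injective x≡y))
  ... | tri> _ _ y<x = inj₂ (inj₂ y<x)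

  _≺?_ : ∀ (x y : PM n) → Dec (x ≺ y)
  x ≺? y = toℤ x ℤP.<? toℤ y

  ≼-≺-trans : ∀ {x y z : PM n} → x ≼ y → y ≺ z → x ≺ z
  ≼-≺-trans = ℤP.≤-<-trans
  ≺-≼-trans : ∀ {x y z : PM n} → x ≺ y → y ≼ z → x ≺ z
  ≺-≼-trans = ℤP.<-≤-trans
  ≺⇒≼ : ∀ {x y : PM n} → x ≺ y → x ≼ y
  ≺⇒≼ = ℤP.<⇒≤
  ≼∧≢⇒≺ : ∀ {x y : PM n} → x ≼ y → x ≢ y → x ≺ y
  ≼∧≢⇒≺ p x≢y = ℤP.≤∧≢⇒< p (x≢y ∘ toℤ-injective)
  ≮⇒≽ : ∀ {x y : PM n} → ¬ (x ≺ y) → y ≼ x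
  ≮⇒≽ = ℤP.≮⇒≥
  ≰⇒≻ : ∀ {x y : PM n} → ¬ (x ≼ y) → y ≺ x
  ≰⇒≻ = ℤP.≰⇒>
  ≼-refl : ∀ {x : PM n} → x ≼ x
  ≼-refl = ℤP.≤-refl
  ≼-antisym : ∀ {x y : PM n} → x ≼ y → y ≼ x → x ≡ y
  ≼-antisym p q = toℤ-injective (ℤP.≤-antisym p q)
  ≼-trans : ∀ {x y z : PM n} → x ≼ y → y ≼ z → x ≼ z
  ≼-trans = ℤP.≤-trans

  <B⇒≺ : ∀ {x y : PM n} → (toℤ x <B toℤ y) ≡ true → x ≺ y
  <B⇒≺ {x} {y} = does-true⇒ (x ≺? y)

  ≺⇒<B : ∀ {x y : PM n} → x ≺ y → (toℤ x <B toℤ y) ≡ true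
  ≺⇒<B {x} {y} = dec-true (x ≺? y)

  ⊀⇒<B : ∀ {x y : PM n} → ¬ (x ≺ y) → (toℤ x <B toℤ y) ≡ false
  ⊀⇒<B {x} {y} = dec-false (x ≺? y)

  <B⇒⊀ : ∀ {x y : PM n} → (toℤ x <B toℤ y) ≡ false → ¬ (x ≺ y)
  <B⇒⊀ {x} {y} = does-false⇒ (x ≺? y)

  _≟PM_ : (x y : PM n) → Dec (x ≡ y)
  _≟PM_ = ≡-dec BoolP._≟_ _≟F_

  ==PM⇒≡ : ∀ {x y : PM n} → x ==PM y ≡ true → x ≡ y
  ==PM⇒≡ {x} {y} = does-true⇒ (x ≟PM y)

  ==PM-refl : ∀ (x : PM n) → x ==PM x ≡ true
  ==PM-refl x = dec-true (x ≟PM x) refl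

  ≢⇒==PM : ∀ {x y : PM n} → x ≢ y → x ==PM y ≡ false
  ≢⇒==PM {x} {y} = dec-false (x ≟PM y)

  ==V⇒≡ : ∀ {c d : VB n} → c ==V d ≡ true → c ≡ d
  ==V⇒≡ {a , b} {c , d} e = let (e₁ , e₂) = ∧-elim e in cong₂ _,_ (==PM⇒≡ e₁) (==PM⇒≡ e₂)

  ==V-refl : ∀ (c : VB n) → c ==V c ≡ true
  ==V-refl (a , b) = ∧-intro (==PM-refl a) (==PM-refl b)

  ≢⇒==V : ∀ {c d : VB n} → c ≢ d → c ==V d ≡ false
  ≢⇒==V {a , b} {c , d} c≢d with a ==PM c in e₁ | b ==PM d in e₂
  ... | true  | true  = ⊥-elim (c≢d (cong₂ _,_ (==PM⇒≡ e₁) (==PM⇒≡ e₂)))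
  ... | true  | false = refl
  ... | false | _     = refl

module _ {n : ℕ} where

  InΛ : VB n → Set
  InΛ (a , b) = a ≺ b × neg a ≼ b

  private
    abs-elim : ∀ (a b : PM n) → ℤ+ ∣ toℤ a ∣ ≤ℤ toℤ b → neg a ≼ b
    abs-elim (true  , i) b p = ℤP.≤-trans -≤+ p
    abs-elim (false , i) b p = p

    abs-intro : ∀ (a b : PM n) → a ≼ b → neg a ≼ b → ℤ+ ∣ toℤ a ∣ ≤ℤ toℤ b
    abs-intro (true  , i) b p q = p
    abs-intro (false , i) b p q = q

  inλ⇒InΛ : ∀ {c : VB n} → inλ c ≡ true → InΛ c
  inλ⇒InΛ {a , b} e =
    let (e₁ , e₂) = ∧-elim e in <B⇒≺ e₁ , abs-elim a b (does-true⇒ (_ ℤP.≤? _) e₂)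

  InΛ⇒inλ : ∀ {c : VB n} → InΛ c → inλ c ≡ true
  InΛ⇒inλ {a , b} (p , q) = ∧-intro (≺⇒<B p) (dec-true (_ ℤP.≤? _) (abs-intro a b (≺⇒≼ p) q))

  ¬InΛ⇒inλ : ∀ {c : VB n} → ¬ InΛ c → inλ c ≡ false
  ¬InΛ⇒inλ {c} ¬l with inλ c in e
  ... | true  = ⊥-elim (¬l (inλ⇒InΛ e))
  ... | false = refl

  InΛ? : (c : VB n) → InΛ c ⊎ ¬ InΛ c
  InΛ? c with bool-cases (inλ c)
  ... | inj₁ e = inj₁ (inλ⇒InΛ e)
  ... | inj₂ e = inj₂ (λ l → true≢false (trans (sym (InΛ⇒inλ l)) e))

  ∈-allPM : ∀ (x : PM n) → x ∈ allPM n
  ∈-allPM (true  , i) = ∈-++⁺ˡ (∈-map⁺ (true ,_) (∈-allFin i))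
  ∈-allPM (false , i) = ∈-++⁺ʳ (map (true ,_) (allFin n)) (∈-map⁺ (false ,_) (∈-allFin i))

  private
    allPairs : List (VB n)
    allPairs = concatMap (λ a → map (a ,_) (allPM n)) (allPM n)

    ∈-allPairs : ∀ (c : VB n) → c ∈ allPairs
    ∈-allPairs (a , b) = ∈-concatMap⁺ (λ a → map (a ,_) (allPM n))
                           (Any.map (λ { refl → ∈-map⁺ (a ,_) (∈-allPM b) }) (∈-allPM a))

  InΛ⇒∈λs : ∀ {c : VB n} → InΛ c → c ∈ λs n
  InΛ⇒∈λs {c} l = ∈-filter⁺ (λ v → BoolP.T? (inλ v)) (∈-allPairs c) (subst T (sym (InΛ⇒inλ l)) _)

  ∈λs⇒InΛ : ∀ {c : VB n} → c ∈ λs n → InΛ c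
  ∈λs⇒InΛ {c} m = inλ⇒InΛ (T⇒≡true (proj₂ (∈-filter⁻ (λ v → BoolP.T? (inλ v)) {xs = allPairs} m)))

  private
    allPM-unique : Unique (allPM n)
    allPM-unique =
      UniqueP.++⁺ (UniqueP.map⁺ (cong proj₂) (UniqueP.allFin⁺ n))
                  (UniqueP.map⁺ (cong proj₂) (UniqueP.allFin⁺ n))
                  disjoint
      where
      disjoint : ∀ {z} → z ∈ map (true ,_) (allFin n) × z ∈ map (false ,_) (allFin n) → ⊥
      disjoint (m₁ , m₂) with ∈-map⁻ (true ,_) m₁ | ∈-map⁻ (false ,_) m₂
      ... | _ , _ , refl | _ , _ , ()

    fst-∈ : ∀ {x y : PM n} {ys zs} → Any (λ a → (x , y) ∈ map (a ,_) ys) zs → x ∈ zs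
    fst-∈ {ys = ys} (here m) with ∈-map⁻ _ m
    ... | _ , _ , refl = here refl
    fst-∈ (there m) = there (fst-∈ m)

    product-unique : ∀ (xs ys : List (PM n)) → Unique xs → Unique ys →
                     Unique (concatMap (λ a → map (a ,_) ys) xs)
    product-unique []       ys _        _  = []
    product-unique (x ∷ xs) ys (x∉ ∷ ux) uy =
      UniqueP.++⁺ (UniqueP.map⁺ (cong proj₂) uy) (product-unique xs ys ux uy) disjoint
      where
      disjoint : ∀ {z} → z ∈ map (x ,_) ys × z ∈ concatMap (λ a → map (a ,_) ys) xs → ⊥
      disjoint (m₁ , m₂) with ∈-map⁻ (x ,_) m₁
      ... | y , _ , refl = All≢⇒∉ x∉ (fst-∈ (∈-concatMap⁻ (λ a → map (a ,_) ys) m₂))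

  λs-unique : Unique (λs n)
  λs-unique = UniqueP.filter⁺ (λ v → BoolP.T? (inλ v))
                (product-unique (allPM n) (allPM n) allPM-unique allPM-unique)

  Shape : VB n → PM n → VB n → Set
  Shape (a , b) k d = d ≡ (k , b) ⊎ d ≡ (a , k) ⊎ d ≡ (neg k , neg a)

  Arc : VB n → VB n → Set
  Arc (a , b) d = InΛ (a , b) × InΛ d × d ≢ (a , b) × Σ (PM n) λ k → a ≺ k × k ≺ b × Shape (a , b) k d

  private
    shape-elim : ∀ {a b d} (k : PM n) →
                 ((d ==V (k , b)) ∨ (d ==V (a , k)) ∨ (d ==V (neg k , neg a))) ≡ true → Shape (a , b) k d
    shape-elim k e with ∨-elim e
    ... | inj₁ e₁ = inj₁ (==V⇒≡ e₁)
    ... | inj₂ e₂ with ∨-elim e₂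
    ... | inj₁ e₃ = inj₂ (inj₁ (==V⇒≡ e₃))
    ... | inj₂ e₄ = inj₂ (inj₂ (==V⇒≡ e₄))

    shape-intro : ∀ {a b d} (k : PM n) → Shape (a , b) k d →
                  ((d ==V (k , b)) ∨ (d ==V (a , k)) ∨ (d ==V (neg k , neg a))) ≡ true
    shape-intro {d = d} k (inj₁ refl) = ∨-introˡ (==V-refl d)
    shape-intro {a} {b} {d} k (inj₂ (inj₁ refl)) = ∨-introʳ (d ==V (k , b)) (∨-introˡ (==V-refl d))
    shape-intro {a} {b} {d} k (inj₂ (inj₂ refl)) =
      ∨-introʳ (d ==V (k , b)) (∨-introʳ (d ==V (a , k)) (==V-refl d))

  arcB⇒Arc : ∀ {c d : VB n} → arcB c d ≡ true → Arc c d
  arcB⇒Arc {a , b} {d} e =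
    let (e₁ , r₁) = ∧-elim e
        (e₂ , r₂) = ∧-elim r₁
        (e₃ , e₄) = ∧-elim r₂
        (k , _ , pk) = any-elim _ (allPM n) e₄
        (q₁ , r₃) = ∧-elim pk
        (q₂ , q₃) = ∧-elim r₃
        d≢c : d ≢ (a , b)
        d≢c = λ { refl → true≢false (trans (sym (==V-refl d)) (BoolP.not-injective e₃)) }
    in inλ⇒InΛ e₁ , inλ⇒InΛ e₂ , d≢c , k , <B⇒≺ q₁ , <B⇒≺ q₂ , shape-elim k q₃

  Arc⇒arcB : ∀ {c d : VB n} → Arc c d → arcB c d ≡ true
  Arc⇒arcB {a , b} {d} (l₁ , l₂ , d≢c , k , ak , kb , sh) =
    ∧-intro (InΛ⇒inλ l₁) (∧-intro (InΛ⇒inλ l₂) (∧-intro (cong not (≢⇒==V d≢c))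
      (any-intro _ (allPM n) (∈-allPM k) (∧-intro (≺⇒<B ak) (∧-intro (≺⇒<B kb) (shape-intro k sh))))))

  Out : VB n → List (VB n)
  Out c = filter (λ d → BoolP.T? (arcB c d)) (λs n)

  Out-unique : ∀ c → Unique (Out c)
  Out-unique c = UniqueP.filter⁺ (λ d → BoolP.T? (arcB c d)) λs-unique

  Arc⇒∈Out : ∀ {c d} → Arc c d → d ∈ Out c
  Arc⇒∈Out {c} {d} p = ∈-filter⁺ (λ d → BoolP.T? (arcB c d)) (InΛ⇒∈λs (proj₁ (proj₂ p)))
                         (subst T (sym (Arc⇒arcB p)) _)

  ∈Out⇒Arc : ∀ {c d} → d ∈ Out c → Arc c d
  ∈Out⇒Arc {c} {d} m = arcB⇒Arc (T⇒≡true (proj₂ (∈-filter⁻ (λ d → BoolP.T? (arcB c d)) {xs = λs n} m)))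

module _ {n : ℕ} where
  swapF-a : ∀ (a b : Fin n) → swapF a b a ≡ b
  swapF-a a b with a ≟F a
  ... | yes _  = refl
  ... | no a≢a = ⊥-elim (a≢a refl)

  swapF-b : ∀ (a b : Fin n) → a ≢ b → swapF a b b ≡ a
  swapF-b a b a≢b with b ≟F a
  ... | yes e = ⊥-elim (a≢b (sym e))
  ... | no _ with b ≟F b
  ... | yes _  = refl
  ... | no b≢b = ⊥-elim (b≢b refl)

  swapF-other : ∀ (a b i : Fin n) → i ≢ a → i ≢ b → swapF a b i ≡ i
  swapF-other a b i i≢a i≢b with i ≟F a
  ... | yes e = ⊥-elim (i≢a e)
  ... | no _ with i ≟F b
  ... | yes e = ⊥-elim (i≢b e)
  ... | no _  = refl

  swapF-involutive : ∀ (a b i : Fin n) → a ≢ b → swapF a b (swapF a b i) ≡ i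
  swapF-involutive a b i a≢b with i ≟F a
  ... | yes refl = swapF-b a b a≢b
  ... | no i≢a with i ≟F b
  ... | yes refl = swapF-a a b
  ... | no i≢b   = swapF-other a b i i≢a i≢b

transpose : ℕ → ℕ → ℕ
transpose i m with m ℕP.≟ i
... | yes _ = suc i
... | no _ with m ℕP.≟ suc i
... | yes _ = i
... | no _  = m

transpose-i : ∀ i → transpose i i ≡ suc i
transpose-i i with i ℕP.≟ i
... | yes _  = refl
... | no i≢i = ⊥-elim (i≢i refl)

transpose-suc : ∀ i → transpose i (suc i) ≡ i
transpose-suc i with suc i ℕP.≟ i
... | yes e = ⊥-elim (ℕP.<-irrefl (sym e) (ℕP.n<1+n i))
... | no _ with suc i ℕP.≟ suc i
... | yes _  = refl
... | no ne  = ⊥-elim (ne refl)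

transpose-other : ∀ i m → m ≢ i → m ≢ suc i → transpose i m ≡ m
transpose-other i m m≢i m≢si with m ℕP.≟ i
... | yes e = ⊥-elim (m≢i e)
... | no _ with m ℕP.≟ suc i
... | yes e = ⊥-elim (m≢si e)
... | no _  = refl

private
  position : ∀ i m → m ≡ i ⊎ m ≡ suc i ⊎ (m ≢ i × m ≢ suc i)
  position i m with m ℕP.≟ i
  ... | yes e = inj₁ e
  ... | no m≢i with m ℕP.≟ suc i
  ... | yes e    = inj₂ (inj₁ e)
  ... | no m≢si  = inj₂ (inj₂ (m≢i , m≢si))

transpose-mono : ∀ i a b → a < b → ¬ (a ≡ i × b ≡ suc i) → transpose i a < transpose i b
transpose-mono i a b a<b not-swapped with position i a | position i b
... | inj₁ refl | inj₁ refl = ⊥-elim (ℕP.<-irrefl refl a<b)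
... | inj₁ refl | inj₂ (inj₁ e) = ⊥-elim (not-swapped (refl , e))
... | inj₁ refl | inj₂ (inj₂ (b≢i , b≢si))
  rewrite transpose-i a | transpose-other a b b≢i b≢si = ℕP.≤∧≢⇒< a<b (b≢si ∘ sym)
... | inj₂ (inj₁ refl) | inj₁ refl = ⊥-elim (ℕP.<-irrefl refl (ℕP.<-trans (ℕP.n<1+n b) a<b))
... | inj₂ (inj₁ refl) | inj₂ (inj₁ refl) = ⊥-elim (ℕP.<-irrefl refl a<b)
... | inj₂ (inj₁ refl) | inj₂ (inj₂ (b≢i , b≢si))
  rewrite transpose-suc i | transpose-other i b b≢i b≢si = ℕP.<-trans (ℕP.n<1+n i) a<b
... | inj₂ (inj₂ (a≢i , a≢si)) | inj₁ refl
  rewrite transpose-other b a a≢i a≢si | transpose-i b = ℕP.m<n⇒m<1+n a<b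
... | inj₂ (inj₂ (a≢i , a≢si)) | inj₂ (inj₁ refl)
  rewrite transpose-other i a a≢i a≢si | transpose-suc i = ℕP.≤∧≢⇒< (ℕP.≤-pred a<b) a≢i
... | inj₂ (inj₂ (a≢i , a≢si)) | inj₂ (inj₂ (b≢i , b≢si))
  rewrite transpose-other i a a≢i a≢si | transpose-other i b b≢i b≢si = a<b

private
  Fin-position : ∀ {n} (a b k : Fin n) → k ≡ a ⊎ k ≡ b ⊎ (k ≢ a × k ≢ b)
  Fin-position a b k with k ≟F a
  ... | yes e = inj₁ e
  ... | no k≢a with k ≟F b
  ... | yes e   = inj₂ (inj₁ e)
  ... | no k≢b  = inj₂ (inj₂ (k≢a , k≢b))

inject₁≢suc : ∀ {m} (i : Fin m) → inject₁ i ≢ suc i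
inject₁≢suc i e = ℕP.<-irrefl (trans (sym (toℕ-inject₁ i)) (cong toℕ e)) (ℕP.n<1+n (toℕ i))

toℕ-swapF : ∀ {m} (i : Fin m) (k : Fin (suc m)) →
            toℕ (swapF (inject₁ i) (suc i) k) ≡ transpose (toℕ i) (toℕ k)
toℕ-swapF i k with Fin-position (inject₁ i) (suc i) k
... | inj₁ refl rewrite swapF-a (inject₁ i) (suc i) | toℕ-inject₁ i | transpose-i (toℕ i) = refl
... | inj₂ (inj₁ refl) rewrite swapF-b (inject₁ i) (suc i) (inject₁≢suc i) | toℕ-inject₁ i =
  sym (transpose-suc (toℕ i))
... | inj₂ (inj₂ (k≢i , k≢si)) rewrite swapF-other (inject₁ i) (suc i) k k≢i k≢si =
  sym (transpose-other (toℕ i) (toℕ k)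
        (λ e → k≢i (toℕ-injective (trans e (sym (toℕ-inject₁ i)))))
        (k≢si ∘ toℕ-injective))

-- s_j exchanges the adjacent values eP j < fP j (and their negatives):
-- eP 0 = -1, fP 0 = 1 and eP j = j, fP j = j+1 for j ≥ 1.
eP fP : Fin n → PM n
eP {suc m} zero    = (false , zero)
eP {suc m} (suc i) = (true , inject₁ i)
fP {suc m} zero    = (true , zero)
fP {suc m} (suc i) = (true , suc i)

Swapped : Fin n → PM n → PM n → Set
Swapped j x y = (x ≡ eP j × y ≡ fP j) ⊎ (x ≡ neg (fP j) × y ≡ neg (eP j))

pos< : ∀ {i k : Fin n} → toℕ i < toℕ k → (true , i) ≺ (true , k)
pos< p = +<+ (s≤s p)
pos<⁻ : ∀ {i k : Fin n} → (true , i) ≺ (true , k) → toℕ i < toℕ k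
pos<⁻ (+<+ (s≤s p)) = p
neg< : ∀ {i k : Fin n} → toℕ k < toℕ i → (false , i) ≺ (false , k)
neg< p = -<- p
neg<⁻ : ∀ {i k : Fin n} → (false , i) ≺ (false , k) → toℕ k < toℕ i
neg<⁻ (-<- p) = p
pos⊀neg : ∀ {i k : Fin n} → ¬ ((true , i) ≺ (false , k))
pos⊀neg ()

≮0 : ∀ {m} → ¬ m < 0
≮0 ()

gen-involutive : ∀ (j : Fin n) x → gen j (gen j x) ≡ x
gen-involutive {suc m} zero    (s , zero)  = cong (_, zero) (BoolP.not-involutive s)
gen-involutive {suc m} zero    (s , suc i) = refl
gen-involutive {suc m} (suc j) (s , i)     =
  cong (s ,_) (swapF-involutive (inject₁ j) (suc j) i (inject₁≢suc j))

gen-odd : ∀ (j : Fin n) x → gen j (neg x) ≡ neg (gen j x)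
gen-odd {suc m} zero    (s , zero)  = refl
gen-odd {suc m} zero    (s , suc i) = refl
gen-odd {suc m} (suc j) (s , i)     = refl

gen-eP : ∀ (j : Fin n) → gen j (eP j) ≡ fP j
gen-eP {suc m} zero    = refl
gen-eP {suc m} (suc j) = cong (true ,_) (swapF-a (inject₁ j) (suc j))

gen-fP : ∀ (j : Fin n) → gen j (fP j) ≡ eP j
gen-fP {suc m} zero    = refl
gen-fP {suc m} (suc j) = cong (true ,_) (swapF-b (inject₁ j) (suc j) (inject₁≢suc j))

eP≺fP : ∀ (j : Fin n) → eP j ≺ fP j
eP≺fP {suc m} zero    = -<+
eP≺fP {suc m} (suc j) = pos< (subst (_< suc (toℕ j)) (sym (toℕ-inject₁ j)) (ℕP.n<1+n (toℕ j)))

eP-fP-adjacent : ∀ (j : Fin n) z → ¬ (eP j ≺ z × z ≺ fP j)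
eP-fP-adjacent {suc m} zero    (true  , k) (p , q) = ≮0 (pos<⁻ q)
eP-fP-adjacent {suc m} zero    (false , k) (p , q) = ≮0 (neg<⁻ p)
eP-fP-adjacent {suc m} (suc j) (true  , k) (p , q) =
  ℕP.<-irrefl refl (ℕP.<-≤-trans (pos<⁻ q) (subst (_< toℕ k) (toℕ-inject₁ j) (pos<⁻ p)))
eP-fP-adjacent {suc m} (suc j) (false , k) (p , q) = pos⊀neg p

private
  from-inject₁ : ∀ {m} (j : Fin m) {k : Fin (suc m)} → toℕ k ≡ toℕ j → k ≡ inject₁ j
  from-inject₁ j e = toℕ-injective (trans e (sym (toℕ-inject₁ j)))

  swapF-mono : ∀ {m} (j : Fin m) (k k' : Fin (suc m)) → toℕ k < toℕ k' →
               ¬ (toℕ k ≡ toℕ j × toℕ k' ≡ suc (toℕ j)) →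
               toℕ (swapF (inject₁ j) (suc j) k) < toℕ (swapF (inject₁ j) (suc j) k')
  swapF-mono j k k' p not-swapped =
    subst₂ _<_ (sym (toℕ-swapF j k)) (sym (toℕ-swapF j k')) (transpose-mono (toℕ j) _ _ p not-swapped)

gen-mono : ∀ (j : Fin n) {x y} → x ≺ y → gen j x ≺ gen j y ⊎ Swapped j x y
gen-mono {suc m} zero {false , zero} {true , zero} p = inj₂ (inj₁ (refl , refl))
gen-mono {suc m} zero {true , zero} {true , zero} (+<+ (s≤s ()))
gen-mono {suc m} zero {false , zero} {false , zero} (-<- ())
gen-mono {suc m} zero {true , zero} {false , zero} ()
gen-mono {suc m} zero {s , zero} {true , suc k} p with s
... | true  = inj₁ -<+
... | false = inj₁ (pos< (s≤s z≤n))
gen-mono {suc m} zero {true , zero} {false , suc k} p = ⊥-elim (pos⊀neg p)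
gen-mono {suc m} zero {false , zero} {false , suc k} (-<- ())
gen-mono {suc m} zero {true , suc k} {true , zero} (+<+ (s≤s ()))
gen-mono {suc m} zero {true , suc k} {false , zero} p = ⊥-elim (pos⊀neg p)
gen-mono {suc m} zero {false , suc k} {s' , zero} p with s'
... | true  = inj₁ (neg< (s≤s z≤n))
... | false = inj₁ -<+
gen-mono {suc m} zero {s , suc k} {s' , suc k'} p = inj₁ p
gen-mono {suc m} (suc j) {true , k} {true , k'} p
  with toSum (k ≟F inject₁ j) | toSum (k' ≟F suc j)
... | inj₁ e₁ | inj₁ e₂ = inj₂ (inj₁ (cong (true ,_) e₁ , cong (true ,_) e₂))
... | inj₂ k≢j | _ = inj₁ (pos< (swapF-mono j k k' (pos<⁻ p) (λ (e , _) → k≢j (from-inject₁ j e))))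
... | inj₁ _ | inj₂ k'≢sj = inj₁ (pos< (swapF-mono j k k' (pos<⁻ p) (λ (_ , e) → k'≢sj (toℕ-injective e))))
gen-mono {suc m} (suc j) {false , k} {false , k'} p
  with toSum (k' ≟F inject₁ j) | toSum (k ≟F suc j)
... | inj₁ e₁ | inj₁ e₂ = inj₂ (inj₂ (cong (false ,_) e₂ , cong (false ,_) e₁))
... | inj₂ k'≢j | _ = inj₁ (neg< (swapF-mono j k' k (neg<⁻ p) (λ (e , _) → k'≢j (from-inject₁ j e))))
... | inj₁ _ | inj₂ k≢sj = inj₁ (neg< (swapF-mono j k' k (neg<⁻ p) (λ (_ , e) → k≢sj (toℕ-injective e))))
gen-mono {suc m} (suc j) {false , k} {true , k'} p = inj₁ -<+
gen-mono {suc m} (suc j) {true , k} {false , k'} p = ⊥-elim (pos⊀neg p)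

select : (A → Bool) → List A → List A
select p = filter (λ v → BoolP.T? (p v))

∈-select : ∀ (p : A → Bool) {xs v} → v ∈ xs → p v ≡ true → v ∈ select p xs
∈-select p m e = ∈-filter⁺ (λ v → BoolP.T? (p v)) m (subst T (sym e) _)

∈-select⁻ : ∀ (p : A → Bool) xs {v} → v ∈ select p xs → v ∈ xs × p v ≡ true
∈-select⁻ p xs m = let (v∈ , pv) = ∈-filter⁻ (λ v → BoolP.T? (p v)) {xs = xs} m in v∈ , T⇒≡true pv

select-unique : ∀ (p : A → Bool) {xs} → Unique xs → Unique (select p xs)
select-unique p = UniqueP.filter⁺ (λ v → BoolP.T? (p v))

select-cong : ∀ (p q : A → Bool) xs → (∀ x → p x ≡ q x) → select p xs ≡ select q xs
select-cong p q xs p≗q =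
  ListP.filter-≐ (λ v → BoolP.T? (p v)) (λ v → BoolP.T? (q v))
    ((λ {x} → subst T (p≗q x)) , (λ {x} → subst T (sym (p≗q x)))) xs

select-none : ∀ (p : A → Bool) xs → (∀ x → x ∈ xs → p x ≡ false) → select p xs ≡ []
select-none p xs none =
  ListP.filter-none (λ v → BoolP.T? (p v))
    (AllP.tabulate (λ {x} m px → true≢false (trans (sym (T⇒≡true px)) (none x m))))

-- This is the shape of Φ(w s_j) versus Φ(w).
module Flip (_≟_ : (x y : A) → Dec (x ≡ y)) (L : List A) (p q : A → Bool) (E : A)
  (uL : Unique L) (E∈L : E ∈ L)
  (agree : ∀ v → v ∈ L → v ≢ E → q v ≡ p v) (qE : q E ≡ true) (pE : p E ≡ false) where

  sub : select p L ⊆ select q L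
  sub m = let (v∈ , pv) = ∈-select⁻ p L m in
          ∈-select q v∈ (trans (agree _ v∈ (λ { refl → true≢false (trans (sym pv) pE) })) pv)

  sup : ∀ {v} → v ∈ select q L → v ∈ select p L ⊎ v ≡ E
  sup {v} m with ∈-select⁻ q L m | v ≟ E
  ... | _         | yes e   = inj₂ e
  ... | (v∈ , qv) | no v≢E = inj₁ (∈-select p v∈ (trans (sym (agree v v∈ v≢E)) qv))

  E∈ : E ∈ select q L
  E∈ = ∈-select q E∈L qE

  E∉ : E ∉ select p L
  E∉ m = true≢false (trans (sym (proj₂ (∈-select⁻ p L m))) pE)

  length-flip : length (select q L) ≡ suc (length (select p L))
  length-flip = ℕP.≤-antisym
    (unique-⊆-length (select-unique q uL) (λ m → [ there , (λ { refl → here refl }) ]′ (sup m)))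
    (unique-⊆-length (unique-∷ E∉ (select-unique p uL)) λ { (here refl) → E∈ ; (there m) → sub m })

idP : SignedPerm n
idP = record { fun = id ; inv = id ; invˡ = λ _ → refl ; invʳ = λ _ → refl ; odd = λ _ → refl }

_·s_ : SignedPerm n → Fin n → SignedPerm n
w ·s j = record
  { fun  = λ x → fun w (gen j x)
  ; inv  = λ x → gen j (inv w x)
  ; invˡ = λ x → trans (cong (gen j) (invˡ w (gen j x))) (gen-involutive j x)
  ; invʳ = λ x → trans (cong (fun w) (gen-involutive j (inv w x))) (invʳ w x)
  ; odd  = λ x → trans (cong (fun w) (gen-odd j x)) (odd w (gen j x))
  }

_·word_ : SignedPerm n → List (Fin n) → SignedPerm n
w ·word []       = w
w ·word (j ∷ js) = (w ·s j) ·word js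

fun-·word : ∀ (w : SignedPerm n) js x → fun (w ·word js) x ≡ fun w (word js x)
fun-·word w []       x = refl
fun-·word w (j ∷ js) x = fun-·word (w ·s j) js x

inv-odd : ∀ (w : SignedPerm n) x → inv w (neg x) ≡ neg (inv w x)
inv-odd w x = trans (cong (inv w) (sym (trans (odd w (inv w x)) (cong neg (invʳ w x)))))
                    (invˡ w (neg (inv w x)))

inv-injective : ∀ (w : SignedPerm n) {a b} → inv w a ≡ inv w b → a ≡ b
inv-injective w {a} {b} e = trans (sym (invʳ w a)) (trans (cong (fun w) e) (invʳ w b))

fun-injective : ∀ (w : SignedPerm n) {a b} → fun w a ≡ fun w b → a ≡ b
fun-injective w {a} {b} e = trans (sym (invˡ w a)) (trans (cong (inv w) e) (invˡ w b))

inv-cong : ∀ {w τ : SignedPerm n} → w ≈B τ → ∀ x → inv w x ≡ inv τ x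
inv-cong {w = w} {τ} w≈τ x =
  trans (cong (inv w) (sym (trans (w≈τ (inv τ x)) (invʳ τ x)))) (invˡ w (inv τ x))

invB : (PM n → PM n) → VB n → Bool
invB P (a , b) = toℤ (P b) <B toℤ (P a)

Φ : SignedPerm n → List (VB n)
Φ {n} w = select (invB (inv w)) (λs n)

Φ-unique : ∀ (w : SignedPerm n) → Unique (Φ w)
Φ-unique w = select-unique (invB (inv w)) λs-unique

∈Φ : ∀ (w : SignedPerm n) {v} → InΛ v → invB (inv w) v ≡ true → v ∈ Φ w
∈Φ w l e = ∈-select (invB (inv w)) (InΛ⇒∈λs l) e

∈Φ⁻ : ∀ (w : SignedPerm n) {v} → v ∈ Φ w → InΛ v × invB (inv w) v ≡ true
∈Φ⁻ {n} w m = let (v∈ , e) = ∈-select⁻ (invB (inv w)) (λs n) m in ∈λs⇒InΛ v∈ , e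

∉Φ : ∀ (w : SignedPerm n) {v} → InΛ v → v ∉ Φ w → invB (inv w) v ≡ false
∉Φ w {v} l v∉ with bool-cases (invB (inv w) v)
... | inj₁ t = ⊥-elim (v∉ (∈Φ w l t))
... | inj₂ f = f

∉Φ⁻ : ∀ (w : SignedPerm n) {v} → invB (inv w) v ≡ false → v ∉ Φ w
∉Φ⁻ w e m = true≢false (trans (sym (proj₂ (∈Φ⁻ w m))) e)

Φ-cong : ∀ (w τ : SignedPerm n) → w ≈B τ → Φ w ≡ Φ τ
Φ-cong {n} w τ w≈τ =
  select-cong (invB (inv w)) (invB (inv τ)) (λs n)
    λ { (a , b) → cong₂ (λ (x y : PM n) → toℤ x <B toℤ y)
                        (inv-cong {w = w} {τ} w≈τ b) (inv-cong {w = w} {τ} w≈τ a) }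

Φ-·s-·s : ∀ (w : SignedPerm n) j → Φ ((w ·s j) ·s j) ≡ Φ w
Φ-·s-·s w j = Φ-cong ((w ·s j) ·s j) w (λ x → cong (fun w) (gen-involutive j x))

Φ-id : Φ {n} idP ≡ []
Φ-id {n} = select-none _ (λs n) λ { (a , b) m → ⊀⇒<B (≺-asym (proj₁ (∈λs⇒InΛ m))) }

invB-true : ∀ {P : PM n → PM n} {a b} → P b ≺ P a → invB P (a , b) ≡ true
invB-true = ≺⇒<B
invB-false : ∀ {P : PM n → PM n} {a b} → P a ≺ P b → invB P (a , b) ≡ false
invB-false p = ⊀⇒<B (≺-asym p)

-- Each pair of distinct values is represented by a unique vertex

PairRep : PM n → PM n → VB n → Set
PairRep x y c = c ≡ (x , y) ⊎ c ≡ (y , x) ⊎ c ≡ (neg y , neg x) ⊎ c ≡ (neg x , neg y)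

private
  neg²-pair : ∀ (x y : PM n) → (x , y) ≡ (neg (neg x) , neg (neg y))
  neg²-pair x y = cong₂ _,_ (sym (neg-involutive x)) (sym (neg-involutive y))

PairRep-rebase : ∀ {x y : PM n} {c c'} → PairRep x y c → PairRep x y c' → PairRep (proj₁ c) (proj₂ c) c'
PairRep-rebase (inj₁ refl) (inj₁ refl) = inj₁ refl
PairRep-rebase (inj₁ refl) (inj₂ (inj₁ refl)) = inj₂ (inj₁ refl)
PairRep-rebase (inj₁ refl) (inj₂ (inj₂ (inj₁ refl))) = inj₂ (inj₂ (inj₁ refl))
PairRep-rebase (inj₁ refl) (inj₂ (inj₂ (inj₂ refl))) = inj₂ (inj₂ (inj₂ refl))
PairRep-rebase (inj₂ (inj₁ refl)) (inj₁ refl) = inj₂ (inj₁ refl)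
PairRep-rebase (inj₂ (inj₁ refl)) (inj₂ (inj₁ refl)) = inj₁ refl
PairRep-rebase (inj₂ (inj₁ refl)) (inj₂ (inj₂ (inj₁ refl))) = inj₂ (inj₂ (inj₂ refl))
PairRep-rebase (inj₂ (inj₁ refl)) (inj₂ (inj₂ (inj₂ refl))) = inj₂ (inj₂ (inj₁ refl))
PairRep-rebase {x = x} {y} (inj₂ (inj₂ (inj₁ refl))) (inj₁ refl) = inj₂ (inj₂ (inj₁ (neg²-pair x y)))
PairRep-rebase {x = x} {y} (inj₂ (inj₂ (inj₁ refl))) (inj₂ (inj₁ refl)) = inj₂ (inj₂ (inj₂ (neg²-pair y x)))
PairRep-rebase (inj₂ (inj₂ (inj₁ refl))) (inj₂ (inj₂ (inj₁ refl))) = inj₁ refl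
PairRep-rebase (inj₂ (inj₂ (inj₁ refl))) (inj₂ (inj₂ (inj₂ refl))) = inj₂ (inj₁ refl)
PairRep-rebase {x = x} {y} (inj₂ (inj₂ (inj₂ refl))) (inj₁ refl) = inj₂ (inj₂ (inj₂ (neg²-pair x y)))
PairRep-rebase {x = x} {y} (inj₂ (inj₂ (inj₂ refl))) (inj₂ (inj₁ refl)) = inj₂ (inj₂ (inj₁ (neg²-pair y x)))
PairRep-rebase (inj₂ (inj₂ (inj₂ refl))) (inj₂ (inj₂ (inj₁ refl))) = inj₂ (inj₁ refl)
PairRep-rebase (inj₂ (inj₂ (inj₂ refl))) (inj₂ (inj₂ (inj₂ refl))) = inj₁ refl

PairRep-swap : ∀ {x y : PM n} {c} → PairRep y x c → PairRep x y c
PairRep-swap (inj₁ e)                 = inj₂ (inj₁ e)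
PairRep-swap (inj₂ (inj₁ e))          = inj₁ e
PairRep-swap (inj₂ (inj₂ (inj₁ e)))   = inj₂ (inj₂ (inj₂ e))
PairRep-swap (inj₂ (inj₂ (inj₂ e)))   = inj₂ (inj₂ (inj₁ e))

InΛ-rep-unique : ∀ {a b : PM n} {c'} → InΛ (a , b) → InΛ c' → PairRep a b c' → c' ≡ (a , b)
InΛ-rep-unique l l' (inj₁ e) = e
InΛ-rep-unique (a≺b , _) (b≺a , _) (inj₂ (inj₁ refl)) = ⊥-elim (≺-asym a≺b b≺a)
InΛ-rep-unique {a = a} {b} (_ , -a≼b) (_ , b≼-a) (inj₂ (inj₂ (inj₁ refl))) =
  cong₂ _,_ (trans (cong neg (sym b≡-a)) (neg-involutive a)) b≡-a
  where
  b≡-a : neg a ≡ b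
  b≡-a = ≼-antisym -a≼b (subst (_≼ neg a) (neg-involutive b) b≼-a)
InΛ-rep-unique (a≺b , _) (p , _) (inj₂ (inj₂ (inj₂ refl))) = ⊥-elim (≺-asym a≺b (≺-neg⁻ p))

InΛ-rep-unique₂ : ∀ {x y : PM n} {c c'} → InΛ c → InΛ c' → PairRep x y c → PairRep x y c' → c' ≡ c
InΛ-rep-unique₂ {c = a , b} l l' r r' = InΛ-rep-unique l l' (PairRep-rebase r r')

orient : PM n → PM n → VB n
orient x y = if inλ (x , y) then (x , y) else (neg y , neg x)

vertexOf : PM n → PM n → VB n
vertexOf x y = if toℤ x <B toℤ y then orient x y else orient y x

orient-spec : ∀ {x y : PM n} → x ≺ y → InΛ (orient x y) × PairRep x y (orient x y)
orient-spec {x = x} {y} x≺y with bool-cases (inλ (x , y))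
... | inj₁ e = subst (λ c → InΛ c × PairRep x y c) (sym (if-true e)) (inλ⇒InΛ e , inj₁ refl)
... | inj₂ e = subst (λ c → InΛ c × PairRep x y c) (sym (if-false e))
    ((≺-neg x≺y , subst (_≼ neg x) (sym (neg-involutive y)) (≺⇒≼ (≰⇒≻ ¬-x≼y))) , inj₂ (inj₂ (inj₁ refl)))
  where ¬-x≼y : ¬ (neg x ≼ y)
        ¬-x≼y q = true≢false (trans (sym (InΛ⇒inλ (x≺y , q))) e)

vertexOf-spec : ∀ {x y : PM n} → x ≢ y → InΛ (vertexOf x y) × PairRep x y (vertexOf x y)
vertexOf-spec {x = x} {y} x≢y with toSum (x ≺? y)
... | inj₁ x≺y = subst (λ c → InΛ c × PairRep x y c) (sym (if-true (≺⇒<B x≺y))) (orient-spec x≺y)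
... | inj₂ x⊀y =
  let (l , r) = orient-spec (≼∧≢⇒≺ (≮⇒≽ x⊀y) (x≢y ∘ sym))
  in subst (λ c → InΛ c × PairRep x y c) (sym (if-false (⊀⇒<B x⊀y))) (l , PairRep-swap r)

vertexOf-unique : ∀ {x y : PM n} {c} → x ≢ y → InΛ c → PairRep x y c → c ≡ vertexOf x y
vertexOf-unique x≢y l r = let (l' , r') = vertexOf-spec x≢y in InΛ-rep-unique₂ l' l r' r

module VertexOrder (Q : PM n → PM n) (Q-odd : ∀ x → Q (neg x) ≡ neg (Q x))
  (Q-injective : ∀ {a b} → Q a ≡ Q b → a ≡ b) {x y : PM n} (x≢y : x ≢ y) where

  private
    not-inverted : ∀ {a b} → a ≢ b → toℤ (Q b) <B toℤ (Q a) ≡ false → Q a ≺ Q b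
    not-inverted a≢b e = ≼∧≢⇒≺ (≮⇒≽ (<B⇒⊀ e)) (a≢b ∘ Q-injective)

  reversed : invB Q (vertexOf x y) ≡ true → (x ≺ y × Q y ≺ Q x) ⊎ (y ≺ x × Q x ≺ Q y)
  reversed e with vertexOf-spec x≢y
  ... | l , inj₁ r rewrite r = inj₁ (proj₁ l , <B⇒≺ e)
  ... | l , inj₂ (inj₁ r) rewrite r = inj₂ (proj₁ l , <B⇒≺ e)
  ... | l , inj₂ (inj₂ (inj₁ r)) rewrite r | Q-odd x | Q-odd y =
    inj₁ (≺-neg⁻ (proj₁ l) , ≺-neg⁻ (<B⇒≺ e))
  ... | l , inj₂ (inj₂ (inj₂ r)) rewrite r | Q-odd x | Q-odd y =
    inj₂ (≺-neg⁻ (proj₁ l) , ≺-neg⁻ (<B⇒≺ e))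

  preserved : invB Q (vertexOf x y) ≡ false → (x ≺ y × Q x ≺ Q y) ⊎ (y ≺ x × Q y ≺ Q x)
  preserved e with vertexOf-spec x≢y
  ... | l , inj₁ r rewrite r = inj₁ (proj₁ l , not-inverted x≢y e)
  ... | l , inj₂ (inj₁ r) rewrite r = inj₂ (proj₁ l , not-inverted (x≢y ∘ sym) e)
  ... | l , inj₂ (inj₂ (inj₁ r)) rewrite r | Q-odd x | Q-odd y =
    inj₁ (≺-neg⁻ (proj₁ l) , ≺-neg⁻ (≼∧≢⇒≺ (≮⇒≽ (<B⇒⊀ e)) (λ q → x≢y (sym (Q-injective (neg-injective q))))))
  ... | l , inj₂ (inj₂ (inj₂ r)) rewrite r | Q-odd x | Q-odd y =
    inj₂ (≺-neg⁻ (proj₁ l) , ≺-neg⁻ (≼∧≢⇒≺ (≮⇒≽ (<B⇒⊀ e)) (λ q → x≢y (Q-injective (neg-injective q)))))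

module InvOrder {n : ℕ} (w : SignedPerm n) {x y : PM n} (x≢y : x ≢ y) =
  VertexOrder (inv w) (inv-odd w) (inv-injective w) x≢y

-- Right multiplication by a generator flips exactly one inversion

module _ (w : SignedPerm n) (j : Fin n) where

  x₀ y₀ : PM n
  x₀ = fun w (eP j)
  y₀ = fun w (fP j)

  -- E(w,j): the vertex whose inversion status changes between w and w s_j
  E : VB n
  E = vertexOf x₀ y₀

  x₀≢y₀ : x₀ ≢ y₀
  x₀≢y₀ e = ≺⇒≢ (eP≺fP j) (fun-injective w e)

  E-spec : InΛ E × PairRep x₀ y₀ E
  E-spec = vertexOf-spec x₀≢y₀

  private
    P P' : PM n → PM n
    P  = inv w
    P' = inv (w ·s j)

  P-x₀ : P x₀ ≡ eP j
  P-x₀ = invˡ w (eP j)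
  P-y₀ : P y₀ ≡ fP j
  P-y₀ = invˡ w (fP j)
  P-neg-x₀ : P (neg x₀) ≡ neg (eP j)
  P-neg-x₀ = trans (inv-odd w x₀) (cong neg P-x₀)
  P-neg-y₀ : P (neg y₀) ≡ neg (fP j)
  P-neg-y₀ = trans (inv-odd w y₀) (cong neg P-y₀)

  P⁻¹ : ∀ {a z} → P a ≡ z → a ≡ fun w z
  P⁻¹ {a} e = trans (sym (invʳ w a)) (cong (fun w) e)

  P⁻¹-neg : ∀ {a z} → P a ≡ neg z → a ≡ neg (fun w z)
  P⁻¹-neg {a} {z} e = trans (P⁻¹ e) (odd w z)

  flip-other : ∀ v → InΛ v → v ≢ E → invB P' v ≡ invB P v
  flip-other (a , b) l v≢E with ≺-cmp (P b) (P a)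
  ... | inj₂ (inj₁ e) = ⊥-elim (≺⇒≢ (proj₁ l) (inv-injective w (sym e)))
  ... | inj₁ p with gen-mono j p
  ...   | inj₁ q = trans (invB-true {P = P'} q) (sym (invB-true {P = P} p))
  ...   | inj₂ (inj₁ (e₁ , e₂)) =
    ⊥-elim (v≢E (vertexOf-unique x₀≢y₀ l (inj₂ (inj₁ (cong₂ _,_ (P⁻¹ e₂) (P⁻¹ e₁))))))
  ...   | inj₂ (inj₂ (e₁ , e₂)) =
    ⊥-elim (v≢E (vertexOf-unique x₀≢y₀ l (inj₂ (inj₂ (inj₂ (cong₂ _,_ (P⁻¹-neg e₂) (P⁻¹-neg e₁)))))))
  flip-other (a , b) l v≢E | inj₂ (inj₂ p) with gen-mono j p
  ...   | inj₁ q = trans (invB-false {P = P'} q) (sym (invB-false {P = P} p))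
  ...   | inj₂ (inj₁ (e₁ , e₂)) =
    ⊥-elim (v≢E (vertexOf-unique x₀≢y₀ l (inj₁ (cong₂ _,_ (P⁻¹ e₁) (P⁻¹ e₂)))))
  ...   | inj₂ (inj₂ (e₁ , e₂)) =
    ⊥-elim (v≢E (vertexOf-unique x₀≢y₀ l (inj₂ (inj₂ (inj₁ (cong₂ _,_ (P⁻¹-neg e₁) (P⁻¹-neg e₂)))))))

  flip-E : invB P' E ≡ not (invB P E)
  flip-E with proj₂ E-spec
  ... | inj₁ e rewrite e | P-x₀ | P-y₀ | gen-eP j | gen-fP j
                     | invB-false {P = id} (eP≺fP j) | invB-true {P = id} (eP≺fP j) = refl
  ... | inj₂ (inj₁ e) rewrite e | P-x₀ | P-y₀ | gen-eP j | gen-fP j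
                     | invB-false {P = id} (eP≺fP j) | invB-true {P = id} (eP≺fP j) = refl
  ... | inj₂ (inj₂ (inj₁ e)) rewrite e | P-neg-x₀ | P-neg-y₀ | gen-odd j (eP j) | gen-odd j (fP j)
                     | gen-eP j | gen-fP j | invB-false {P = id} (≺-neg (eP≺fP j))
                     | invB-true {P = id} (≺-neg (eP≺fP j)) = refl
  ... | inj₂ (inj₂ (inj₂ e)) rewrite e | P-neg-x₀ | P-neg-y₀ | gen-odd j (eP j) | gen-odd j (fP j)
                     | gen-eP j | gen-fP j | invB-false {P = id} (≺-neg (eP≺fP j))
                     | invB-true {P = id} (≺-neg (eP≺fP j)) = refl

ascent : ∀ (w : SignedPerm n) j → invB (inv w) (E w j) ≡ false → x₀ w j ≺ y₀ w j
ascent w j e with InvOrder.preserved w (x₀≢y₀ w j) e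
... | inj₁ (p , _) = p
... | inj₂ (_ , q) rewrite P-x₀ w j | P-y₀ w j = ⊥-elim (≺-asym q (eP≺fP j))

descent : ∀ (w : SignedPerm n) j → invB (inv w) (E w j) ≡ true → y₀ w j ≺ x₀ w j
descent w j e with InvOrder.reversed w (x₀≢y₀ w j) e
... | inj₁ (_ , q) rewrite P-x₀ w j | P-y₀ w j = ⊥-elim (≺-asym q (eP≺fP j))
... | inj₂ (p , _) = p

_≟V_ : (c d : VB n) → Dec (c ≡ d)
_≟V_ = ≡-dec _≟PM_ _≟PM_

module FlipStep (w : SignedPerm n) (j : Fin n) where

  Up : Set
  Up = invB (inv w) (E w j) ≡ false × E w j ∉ Φ w × E w j ∈ Φ (w ·s j)
     × length (Φ (w ·s j)) ≡ suc (length (Φ w))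
     × Φ w ⊆ Φ (w ·s j) × (∀ {v} → v ∈ Φ (w ·s j) → v ∈ Φ w ⊎ v ≡ E w j)

  Down : Set
  Down = invB (inv w) (E w j) ≡ true × E w j ∈ Φ w × E w j ∉ Φ (w ·s j)
       × length (Φ w) ≡ suc (length (Φ (w ·s j)))
       × Φ (w ·s j) ⊆ Φ w × (∀ {v} → v ∈ Φ w → v ∈ Φ (w ·s j) ⊎ v ≡ E w j)

  flip-step : Up ⊎ Down
  flip-step with bool-cases (invB (inv w) (E w j))
  ... | inj₂ f = inj₁ (f , F.E∉ , F.E∈ , F.length-flip , F.sub , F.sup)
    where module F = Flip _≟V_ (λs n) (invB (inv w)) (invB (inv (w ·s j))) (E w j) λs-unique
                       (InΛ⇒∈λs (proj₁ (E-spec w j)))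
                       (λ v v∈ v≢E → flip-other w j v (∈λs⇒InΛ v∈) v≢E) (trans (flip-E w j) (cong not f)) f
  ... | inj₁ t = inj₂ (t , F.E∈ , F.E∉ , F.length-flip , F.sub , F.sup)
    where module F = Flip _≟V_ (λs n) (invB (inv (w ·s j))) (invB (inv w)) (E w j) λs-unique
                       (InΛ⇒∈λs (proj₁ (E-spec w j)))
                       (λ v v∈ v≢E → sym (flip-other w j v (∈λs⇒InΛ v∈) v≢E)) t (trans (flip-E w j) (cong not t))

-- A signed permutation is determined by its inversion set

module Increasing {m : ℕ} (h : Fin (suc m) → Fin (suc m))
  (increasing : ∀ (i : Fin m) → toℕ (h (inject₁ i)) < toℕ (h (suc i))) where

  private
    above : ∀ t (i : Fin (suc m)) → toℕ i ≡ t → toℕ i ≤ toℕ (h i)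
    above _       zero    _ = z≤n
    above (suc t) (suc i) e =
      ℕP.≤-<-trans (subst (_≤ toℕ (h (inject₁ i))) (toℕ-inject₁ i)
                           (above t (inject₁ i) (trans (toℕ-inject₁ i) (ℕP.suc-injective e))))
                   (increasing i)

    below : ∀ d (i : Fin (suc m)) → toℕ i + d ≡ m → toℕ (h i) ≤ toℕ i
    below zero i e =
      subst (toℕ (h i) ≤_) (trans (sym e) (ℕP.+-identityʳ (toℕ i))) (ℕP.≤-pred (toℕ<n (h i)))
    below (suc d) i e = ℕP.≤-pred (ℕP.<-≤-trans step (subst (toℕ (h (suc i')) ≤_) (cong suc (toℕ-fromℕ< i<m)) ih))
      where
      i<m : toℕ i < m
      i<m = subst (toℕ i <_) e (subst (_≤ toℕ i + suc d) (ℕP.+-comm (toℕ i) 1) (ℕP.+-monoʳ-≤ (toℕ i) (s≤s z≤n)))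
      i' : Fin m
      i' = fromℕ< i<m
      inject-i' : inject₁ i' ≡ i
      inject-i' = toℕ-injective (trans (toℕ-inject₁ i') (toℕ-fromℕ< i<m))
      ih : toℕ (h (suc i')) ≤ toℕ (suc i')
      ih = below d (suc i') (trans (cong (λ z → suc z + d) (toℕ-fromℕ< i<m)) (trans (sym (ℕP.+-suc (toℕ i) d)) e))
      step : toℕ (h i) < toℕ (h (suc i'))
      step = subst (λ z → toℕ (h z) < toℕ (h (suc i'))) inject-i' (increasing i')

  increasing-id : ∀ i → h i ≡ i
  increasing-id i = toℕ-injective (ℕP.≤-antisym
    (below _ i (ℕP.m+[n∸m]≡n (ℕP.≤-pred (toℕ<n i)))) (above _ i refl))

-- An odd map f with f(e_j) < f(f_j) for every generator is the identity:
-- f(-1) < f(1) forces f(1) > 0, so f(1) < f(2) < ⋯ < f(n) are positive and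
-- strictly increasing, hence f(i) = i.
ascending-id : ∀ (f : PM n → PM n) → (∀ x → f (neg x) ≡ neg (f x)) →
               (∀ j → f (eP j) ≺ f (fP j)) → ∀ x → f x ≡ x
ascending-id {zero}  f _     _    (_ , ())
ascending-id {suc m} f f-odd mono = fixed
  where
  positive-value : ∀ {y : PM (suc m)} → neg y ≺ y → Σ (Fin (suc m)) λ k → y ≡ (true , k)
  positive-value {true  , k} _ = k , refl
  positive-value {false , k} p = ⊥-elim (pos⊀neg p)

  positive : ∀ t (i : Fin (suc m)) → toℕ i ≡ t → Σ (Fin (suc m)) λ k → f (true , i) ≡ (true , k)
  positive _ zero _ = positive-value (subst (_≺ f (true , zero)) (f-odd (true , zero)) (mono zero))
  positive (suc t) (suc i) e
    with positive t (inject₁ i) (trans (toℕ-inject₁ i) (ℕP.suc-injective e))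
  ... | k , fi≡k with f (true , suc i) | mono (suc i)
  ...   | true  , k' | _ = k' , refl
  ...   | false , _  | p rewrite fi≡k = ⊥-elim (pos⊀neg p)

  h : Fin (suc m) → Fin (suc m)
  h i = proj₁ (positive _ i refl)

  f≡h : ∀ i → f (true , i) ≡ (true , h i)
  f≡h i = proj₂ (positive _ i refl)

  fixed : ∀ x → f x ≡ x
  fixed (true , i) = trans (f≡h i) (cong (true ,_) (Increasing.increasing-id h increasing i))
    where
    increasing : ∀ (i : Fin m) → toℕ (h (inject₁ i)) < toℕ (h (suc i))
    increasing i = pos<⁻ (subst₂ _≺_ (f≡h (inject₁ i)) (f≡h (suc i)) (mono (suc i)))
  fixed (false , i) = trans (f-odd (true , i)) (cong neg (fixed (true , i)))

E-InΛ : ∀ (w : SignedPerm n) j → InΛ (E w j)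
E-InΛ w j = proj₁ (E-spec w j)

-- If Φ(w) ⊆ Φ(τ) and τ inverts none of the ascent vertices of w, then
-- w = τ: τ⁻¹ ∘ w keeps every generator pair in order.
Φ-determines : ∀ (w τ : SignedPerm n) → Φ w ⊆ Φ τ → (∀ j → E w j ∉ Φ w → E w j ∉ Φ τ) → w ≈B τ
Φ-determines w τ Φw⊆Φτ ascents-kept x =
  trans (sym (invʳ τ (fun w x))) (cong (fun τ) (ascending-id f f-odd mono x))
  where
  f : PM _ → PM _
  f z = inv τ (fun w z)
  f-odd : ∀ z → f (neg z) ≡ neg (f z)
  f-odd z = trans (cong (inv τ) (odd w z)) (inv-odd τ (fun w z))
  mono : ∀ j → f (eP j) ≺ f (fP j)
  mono j with bool-cases (invB (inv w) (E w j))
  ... | inj₂ asc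
    with InvOrder.preserved τ (x₀≢y₀ w j) (∉Φ τ (E-InΛ w j) (ascents-kept j (∉Φ⁻ w asc)))
  ...   | inj₁ (_ , q) = q
  ...   | inj₂ (p , _) = ⊥-elim (≺-asym p (ascent w j asc))
  mono j | inj₁ desc
    with InvOrder.reversed τ (x₀≢y₀ w j) (proj₂ (∈Φ⁻ τ (Φw⊆Φτ (∈Φ w (E-InΛ w j) desc))))
  ...   | inj₁ (p , _) = ⊥-elim (≺-asym p (descent w j desc))
  ...   | inj₂ (_ , q) = q

no-descent⇒id : ∀ (w : SignedPerm n) → (∀ j → invB (inv w) (E w j) ≡ false) → w ≈B idP
no-descent⇒id w asc = ascending-id (fun w) (odd w) (λ j → ascent w j (asc j))

descent-exists : ∀ (w : SignedPerm n) → length (Φ w) ≢ 0 → Σ (Fin n) λ j → invB (inv w) (E w j) ≡ true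
descent-exists {n} w Φw≢[] with any? (λ j → invB (inv w) (E w j) BoolP.≟ true)
... | yes d = d
... | no none = ⊥-elim (Φw≢[] (cong length (trans (Φ-cong w idP (no-descent⇒id w asc)) (Φ-id {n}))))
  where
  asc : ∀ j → invB (inv w) (E w j) ≡ false
  asc j with bool-cases (invB (inv w) (E w j))
  ... | inj₁ t = ⊥-elim (none (j , t))
  ... | inj₂ f = f

-- Length is the number of inversions; the weak order is inclusion

word-∷ʳ : ∀ (js : List (Fin n)) j x → word (js ∷ʳ j) x ≡ word js (gen j x)
word-∷ʳ []       j x = refl
word-∷ʳ (k ∷ js) j x = cong (gen k) (word-∷ʳ js j x)

-- w has a word of length |Φ(w)|: repeatedly strip a descent.
short-word : ∀ k (w : SignedPerm n) → length (Φ w) ≡ k → Σ (List (Fin n)) λ js → Represents js w × length js ≡ k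
short-word zero w e =
  [] , (λ x → sym (no-descent⇒id w asc x)) , refl
  where
  asc : ∀ j → invB (inv w) (E w j) ≡ false
  asc j = ∉Φ w (E-InΛ w j) λ m → ℕP.0≢1+n (trans (sym e) (length-remove (Φ w) m))
short-word (suc k) w e with descent-exists w (λ e' → ℕP.0≢1+n (trans (sym e') e))
... | j , desc with FlipStep.flip-step w j
...   | inj₁ up = ⊥-elim (true≢false (trans (sym desc) (proj₁ up)))
...   | inj₂ (_ , _ , _ , length-down , _) =
  let (js , rep , len) = short-word k (w ·s j) (ℕP.suc-injective (trans (sym length-down) e))
  in (js ∷ʳ j) ,
     (λ x → trans (word-∷ʳ js j x) (trans (rep (gen j x)) (cong (fun w) (gen-involutive j x)))) ,
     trans (ListP.length-++ js) (trans (ℕP.+-comm (length js) 1) (cong suc len))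

word-Φ : ∀ (js : List (Fin n)) (w : SignedPerm n) →
         length (Φ (w ·word js)) ≤ length (Φ w) + length js
         × (length (Φ (w ·word js)) ≡ length (Φ w) + length js → Φ w ⊆ Φ (w ·word js))
word-Φ [] w = ℕP.m≤m+n _ 0 , (λ _ m → m)
word-Φ (j ∷ js) w with word-Φ js (w ·s j) | FlipStep.flip-step w j
... | bound , grew | inj₁ (_ , _ , _ , length-up , Φw⊆ , _) =
  subst (length (Φ ((w ·s j) ·word js)) ≤_) shift bound ,
  λ eq m → grew (trans eq (sym shift)) (Φw⊆ m)
  where
  shift : length (Φ (w ·s j)) + length js ≡ length (Φ w) + suc (length js)
  shift = trans (cong (_+ length js) length-up) (sym (ℕP.+-suc (length (Φ w)) (length js)))
... | bound , _ | inj₂ (_ , _ , _ , length-down , _ , _) =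
  ℕP.≤-trans bound (subst (length (Φ (w ·s j)) + length js ≤_) (cong (_+ suc (length js)) (sym length-down))
                      (ℕP.+-mono-≤ (ℕP.n≤1+n _) (ℕP.n≤1+n _))) ,
  λ eq → ⊥-elim (ℕP.<-irrefl eq (ℕP.≤-<-trans bound gap))
  where
  a b : ℕ
  a = length (Φ (w ·s j))
  b = length js
  -- a descent step loses one inversion, so the word cannot be length-additive
  gap : a + b < length (Φ w) + suc b
  gap = subst (a + b <_) (cong (_+ suc b) (sym length-down)) (s≤s (ℕP.+-monoʳ-≤ a (ℕP.n≤1+n b)))

word-length-≥ : ∀ (w : SignedPerm n) js → Represents js w → length (Φ w) ≤ length js
word-length-≥ {n} w js rep =
  subst (_≤ length js) (cong length (sym (Φ-cong w (idP ·word js) w≈idjs)))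
    (subst (λ z → length (Φ (idP ·word js)) ≤ length z + length js) (Φ-id {n}) (proj₁ (word-Φ js idP)))
  where
  w≈idjs : w ≈B (idP ·word js)
  w≈idjs x = trans (sym (rep x)) (sym (fun-·word idP js x))

length-Φ : ∀ (w : SignedPerm n) → HasLength w (length (Φ w))
length-Φ w = let (js , rep , len) = short-word (length (Φ w)) w refl in (js , len , rep) , word-length-≥ w

HasLength-unique : ∀ {w : SignedPerm n} {k k'} → HasLength w k → HasLength w k' → k ≡ k'
HasLength-unique ((js , len , rep) , min) ((js' , len' , rep') , min') =
  ℕP.≤-antisym (subst (_ ≤_) len' (min js' rep')) (subst (_ ≤_) len (min' js rep))

-- w ≤_R τ ⇒ Φ(w) ⊆ Φ(τ): a length-additive word only adds inversions.
≤R⇒⊆ : ∀ (w τ : SignedPerm n) → w ≤R τ → Φ w ⊆ Φ τ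
≤R⇒⊆ w τ (js , τ≡wjs , k , ℓw , ℓτ) m =
  subst (_ ∈_) (Φ-cong (w ·word js) τ wjs≈τ) (proj₂ (word-Φ js w) additive m)
  where
  wjs≈τ : (w ·word js) ≈B τ
  wjs≈τ x = trans (fun-·word w js x) (sym (τ≡wjs x))
  additive : length (Φ (w ·word js)) ≡ length (Φ w) + length js
  additive = trans (cong length (Φ-cong (w ·word js) τ wjs≈τ))
               (trans (HasLength-unique {w = τ} (length-Φ τ) ℓτ)
                      (cong (_+ length js) (HasLength-unique {w = w} ℓw (length-Φ w))))

-- Φ(w) ⊆ Φ(τ) ⇒ w ≤_R τ: climb from w towards τ along ascents whose flip
-- vertex is an inversion of τ; each step keeps Φ(w) ⊆ Φ(τ).
module Climb (τ : SignedPerm n) where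

  private
    full : ∀ (w : SignedPerm n) → Φ w ⊆ Φ τ → length (Φ τ) ≡ length (Φ w) →
           ∀ j → E w j ∉ Φ w → E w j ∉ Φ τ
    full w Φw⊆ same j E∉ E∈ =
      ℕP.<-irrefl refl (subst (suc (length (Φ w)) ≤_) same
        (unique-⊆-length (unique-∷ E∉ (Φ-unique w)) λ { (here refl) → E∈ ; (there m) → Φw⊆ m }))

  climb : ∀ d (w : SignedPerm n) → length (Φ τ) ≡ length (Φ w) + d → Φ w ⊆ Φ τ →
          Σ (List (Fin n)) λ js → τ ≈B (w ·word js) × length js ≡ d
  climb zero w e Φw⊆ =
    [] , (λ x → sym (Φ-determines w τ Φw⊆ (full w Φw⊆ (trans e (ℕP.+-identityʳ _))) x)) , refl
  climb (suc d) w e Φw⊆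
    with any? (λ j → ≡-dec BoolP._≟_ BoolP._≟_ (invB (inv w) (E w j) , invB (inv τ) (E w j)) (false , true))
  ... | yes (j , e-asc) with FlipStep.flip-step w j
  ...   | inj₂ down = ⊥-elim (true≢false (trans (sym (proj₁ down)) (cong proj₁ e-asc)))
  ...   | inj₁ (_ , _ , _ , length-up , _ , new) =
    let (js , τ≈ , len) = climb d (w ·s j) e' Φws⊆ in (j ∷ js) , τ≈ , cong suc len
    where
    Φws⊆ : Φ (w ·s j) ⊆ Φ τ
    Φws⊆ m with new m
    ... | inj₁ m' = Φw⊆ m'
    ... | inj₂ refl = ∈Φ τ (E-InΛ w j) (cong proj₂ e-asc)
    e' : length (Φ τ) ≡ length (Φ (w ·s j)) + d
    e' = trans e (trans (ℕP.+-suc _ d) (cong (_+ d) (sym length-up)))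
  climb (suc d) w e Φw⊆ | no none =
    ⊥-elim (ℕP.<-irrefl refl (subst (length (Φ w) <_) (trans (sym e) same) (ℕP.m<m+n (length (Φ w)) (s≤s z≤n))))
    where
    kept : ∀ j → E w j ∉ Φ w → E w j ∉ Φ τ
    kept j E∉ E∈ = none (j , cong₂ _,_ (∉Φ w (E-InΛ w j) E∉) (proj₂ (∈Φ⁻ τ E∈)))
    same : length (Φ τ) ≡ length (Φ w)
    same = cong length (sym (Φ-cong w τ (Φ-determines w τ Φw⊆ kept)))

⊆⇒≤R : ∀ (w τ : SignedPerm n) → Φ w ⊆ Φ τ → w ≤R τ
⊆⇒≤R w τ Φw⊆ =
  let (js , τ≈ , len) = Climb.climb τ d w room Φw⊆ in
  js , (λ x → trans (τ≈ x) (fun-·word w js x)) , length (Φ w) , length-Φ w ,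
  subst (HasLength τ) (trans room (cong (length (Φ w) +_) (sym len))) (length-Φ τ)
  where
  d : ℕ
  d = length (Φ τ) ∸ length (Φ w)
  room : length (Φ τ) ≡ length (Φ w) + d
  room = sym (ℕP.m+[n∸m]≡n (unique-⊆-length (Φ-unique w) Φw⊆))

-- Out-neighbourhoods come in partner pairs

-- For c = (a , b) and a < k < b the out-neighbours through k are
-- upper c k = (k , b) and lower c k, the vertex of λ_n^s representing {a , k}
-- (written explicitly: (-k , b) if a = -b, else (a , k) or (-k , -a)).
upper : VB n → PM n → VB n
upper (a , b) k = (k , b)

lower : VB n → PM n → VB n
lower (a , b) k =
  if a ==PM neg b then (neg k , b) else (if inλ (a , k) then (a , k) else (neg k , neg a))

-- the involution exchanging upper c k and lower c k
partner : VB n → VB n → VB n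
partner (a , b) (x , y) =
  if a ==PM neg b then (neg x , y) else
  (if y ==PM b then lower (a , b) x else (if x ==PM a then (y , b) else (neg x , b)))

module Partners {a b : PM n} (c∈Λ : InΛ (a , b)) where
  c : VB n
  c = (a , b)

  private
    ==PM-self : ∀ {x y : PM n} → x ≡ y → x ==PM y ≡ true
    ==PM-self {x} refl = ==PM-refl x

  lower-sym : ∀ {k} → a ≡ neg b → lower c k ≡ (neg k , b)
  lower-sym e = if-true (==PM-self e)
  lower-in : ∀ {k} → a ≢ neg b → InΛ (a , k) → lower c k ≡ (a , k)
  lower-in a≢-b l = trans (if-false (≢⇒==PM a≢-b)) (if-true (InΛ⇒inλ l))
  lower-out : ∀ {k} → a ≢ neg b → ¬ InΛ (a , k) → lower c k ≡ (neg k , neg a)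
  lower-out a≢-b ¬l = trans (if-false (≢⇒==PM a≢-b)) (if-false (¬InΛ⇒inλ ¬l))

  partner-sym : ∀ {x y} → a ≡ neg b → partner c (x , y) ≡ (neg x , y)
  partner-sym e = if-true (==PM-self e)
  partner-upper : ∀ {x y} → a ≢ neg b → y ≡ b → partner c (x , y) ≡ lower c x
  partner-upper a≢-b e = trans (if-false (≢⇒==PM a≢-b)) (if-true (==PM-self e))
  partner-in : ∀ {x y} → a ≢ neg b → y ≢ b → x ≡ a → partner c (x , y) ≡ (y , b)
  partner-in a≢-b y≢b e =
    trans (if-false (≢⇒==PM a≢-b)) (trans (if-false (≢⇒==PM y≢b)) (if-true (==PM-self e)))
  partner-out : ∀ {x y} → a ≢ neg b → y ≢ b → x ≢ a → partner c (x , y) ≡ (neg x , b)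
  partner-out a≢-b y≢b x≢a =
    trans (if-false (≢⇒==PM a≢-b)) (trans (if-false (≢⇒==PM y≢b)) (if-false (≢⇒==PM x≢a)))

  -b≼a : neg b ≼ a
  -b≼a = subst (neg b ≼_) (neg-involutive a) (≼-neg (proj₂ c∈Λ))

  module Through {k : PM n} (a≺k : a ≺ k) (k≺b : k ≺ b) where
    -k≺b : neg k ≺ b
    -k≺b = subst (neg k ≺_) (neg-involutive b) (≺-neg (≼-≺-trans -b≼a a≺k))

    arc-upper : Arc c (upper c k)
    arc-upper = c∈Λ , (k≺b , ≺⇒≼ -k≺b) , (λ e → ≺⇒≢ a≺k (sym (cong proj₁ e))) , k , a≺k , k≺b , inj₁ refl

    lower-InΛ : InΛ (lower c k)
    lower-InΛ with toSum (a ≟PM neg b) | InΛ? (a , k)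
    ... | inj₁ e | _ rewrite lower-sym {k} e =
      -k≺b , subst (_≼ b) (sym (neg-involutive k)) (≺⇒≼ k≺b)
    ... | inj₂ a≢-b | inj₁ l rewrite lower-in a≢-b l = l
    ... | inj₂ a≢-b | inj₂ ¬l rewrite lower-out a≢-b ¬l =
      ≺-neg a≺k , subst (_≼ neg a) (sym (neg-involutive k)) (≺⇒≼ (≰⇒≻ (λ q → ¬l (a≺k , q))))

    arc-lower : Arc c (lower c k)
    arc-lower with toSum (a ≟PM neg b) | InΛ? (a , k)
    ... | inj₁ e | _ =
      c∈Λ , lower-InΛ ,
      (λ q → ≺⇒≢ k≺b (neg-injective (trans (cong proj₁ (trans (sym (lower-sym e)) q)) e))) ,
      k , a≺k , k≺b ,
      inj₂ (inj₂ (trans (lower-sym e) (cong (neg k ,_) (trans (sym (neg-involutive b)) (cong neg (sym e))))))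
    ... | inj₂ a≢-b | inj₁ l =
      c∈Λ , lower-InΛ , (λ q → ≺⇒≢ k≺b (cong proj₂ (trans (sym (lower-in a≢-b l)) q))) ,
      k , a≺k , k≺b , inj₂ (inj₁ (lower-in a≢-b l))
    ... | inj₂ a≢-b | inj₂ ¬l =
      c∈Λ , lower-InΛ ,
      (λ q → a≢-b (trans (sym (neg-involutive a)) (cong neg (cong proj₂ (trans (sym (lower-out a≢-b ¬l)) q))))) ,
      k , a≺k , k≺b , inj₂ (inj₂ (lower-out a≢-b ¬l))

    partner-of-upper : partner c (upper c k) ≡ lower c k
    partner-of-upper with toSum (a ≟PM neg b)
    ... | inj₁ e     = trans (partner-sym e) (sym (lower-sym e))
    ... | inj₂ a≢-b = partner-upper a≢-b refl

    partner-of-lower : partner c (lower c k) ≡ upper c k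
    partner-of-lower with toSum (a ≟PM neg b) | InΛ? (a , k)
    ... | inj₁ e | _ rewrite lower-sym {k} e = trans (partner-sym e) (cong (_, b) (neg-involutive k))
    ... | inj₂ a≢-b | inj₁ l rewrite lower-in a≢-b l = partner-in a≢-b (≺⇒≢ k≺b) refl
    ... | inj₂ a≢-b | inj₂ ¬l rewrite lower-out a≢-b ¬l =
      trans (partner-out a≢-b (λ q → a≢-b (trans (sym (neg-involutive a)) (cong neg q))) -k≢a)
            (cong (_, b) (neg-involutive k))
      where
      -k≢a : neg k ≢ a
      -k≢a q = ¬l (subst (λ z → InΛ (a , z)) k≡-a (subst (a ≺_) (sym k≡-a) a≺k , ≼-refl))
        where k≡-a = trans (cong neg (sym q)) (neg-involutive k)

    upper≢lower : upper c k ≢ lower c k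
    upper≢lower with toSum (a ≟PM neg b) | InΛ? (a , k)
    ... | inj₁ e | _ rewrite lower-sym {k} e = λ q → neg≢ k (sym (cong proj₁ q))
    ... | inj₂ a≢-b | inj₁ l rewrite lower-in a≢-b l = λ q → ≺⇒≢ a≺k (sym (cong proj₁ q))
    ... | inj₂ a≢-b | inj₂ ¬l rewrite lower-out a≢-b ¬l = λ q → neg≢ k (sym (cong proj₁ q))

  out-decomp : ∀ {d} → Arc c d → Σ (PM n) λ k → a ≺ k × k ≺ b × (d ≡ upper c k ⊎ d ≡ lower c k)
  out-decomp (_ , _ , _ , k , a≺k , k≺b , inj₁ e) = k , a≺k , k≺b , inj₁ e
  out-decomp (_ , d∈Λ , _ , k , a≺k , k≺b , inj₂ (inj₁ refl)) with toSum (a ≟PM neg b)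
  ... | inj₁ e =
    ⊥-elim (≺-irrefl (≺-≼-trans k≺b (subst (_≼ k) (trans (cong neg e) (neg-involutive b)) (proj₂ d∈Λ))))
  ... | inj₂ a≢-b = k , a≺k , k≺b , inj₂ (sym (lower-in a≢-b d∈Λ))
  out-decomp (_ , d∈Λ , _ , k , a≺k , k≺b , inj₂ (inj₂ refl)) with toSum (a ≟PM neg b) | InΛ? (a , k)
  ... | inj₁ e | _ =
    k , a≺k , k≺b , inj₂ (trans (cong (neg k ,_) (trans (cong neg e) (neg-involutive b))) (sym (lower-sym e)))
  ... | inj₂ a≢-b | inj₂ ¬l = k , a≺k , k≺b , inj₂ (sym (lower-out a≢-b ¬l))
  ... | inj₂ a≢-b | inj₁ l = k , a≺k , k≺b , inj₂ (trans same (sym (lower-in a≢-b l)))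
    where
    k≡-a : k ≡ neg a
    k≡-a = ≼-antisym (subst (_≼ neg a) (neg-involutive k) (proj₂ d∈Λ)) (proj₂ l)
    same : (neg k , neg a) ≡ (a , k)
    same = cong₂ _,_ (trans (cong neg k≡-a) (neg-involutive a)) (sym k≡-a)

  module LowerInversion (Q : PM n → PM n) (Q-odd : ∀ x → Q (neg x) ≡ neg (Q x)) where

    lower-inverted : ∀ {k} → Q k ≺ Q a → invB Q (lower c k) ≡ true
    lower-inverted {k} p with toSum (a ≟PM neg b) | InΛ? (a , k)
    ... | inj₁ e | _ rewrite lower-sym {k} e | Q-odd k =
      ≺⇒<B (subst (_≺ neg (Q k)) (trans (cong neg (trans (cong Q e) (Q-odd b))) (neg-involutive (Q b))) (≺-neg p))
    ... | inj₂ a≢-b | inj₁ l rewrite lower-in a≢-b l = ≺⇒<B p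
    ... | inj₂ a≢-b | inj₂ ¬l rewrite lower-out a≢-b ¬l | Q-odd a | Q-odd k = ≺⇒<B (≺-neg p)

    lower-inverted⁻ : ∀ {k} → invB Q (lower c k) ≡ true → Q k ≺ Q a
    lower-inverted⁻ {k} t with toSum (a ≟PM neg b) | InΛ? (a , k)
    ... | inj₁ e | _ rewrite lower-sym {k} e | Q-odd k =
      subst (Q k ≺_) (sym (trans (cong Q e) (Q-odd b)))
        (subst (_≺ neg (Q b)) (neg-involutive (Q k)) (≺-neg (<B⇒≺ t)))
    ... | inj₂ a≢-b | inj₁ l rewrite lower-in a≢-b l = <B⇒≺ t
    ... | inj₂ a≢-b | inj₂ ¬l rewrite lower-out a≢-b ¬l | Q-odd a | Q-odd k = ≺-neg⁻ (<B⇒≺ t)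

-- Values after peeling an inversion set

private
  half-∸-zero : ∀ L G → L ≤ G + G → ⌊ L /2⌋ ∸ G ≡ 0
  half-∸-zero L G p = ℕP.m≤n⇒m∸n≡0 (subst (⌊ L /2⌋ ≤_) (sym (ℕP.n≡⌊n+n/2⌋ G)) (ℕP.⌊n/2⌋-mono p))

  half-∸-nonzero : ∀ L G → suc (suc (G + G)) ≤ L → ⌊ L /2⌋ ∸ G ≢ 0
  half-∸-nonzero L G p e =
    ℕP.<-irrefl refl (subst (1 ≤_) e (subst (_≤ ⌊ L /2⌋ ∸ G) (ℕP.m+n∸n≡m 1 G) (ℕP.∸-monoˡ-≤ G G<half)))
    where
    G<half : suc G ≤ ⌊ L /2⌋
    G<half = subst (_≤ ⌊ L /2⌋) (sym (ℕP.n≡⌊n+n/2⌋ (suc G)))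
               (ℕP.⌊n/2⌋-mono (subst (_≤ L) (cong suc (sym (ℕP.+-suc G G))) p))

cnt≡length : ∀ (y : VB n) R → Peeling.cnt (λs n) (arcB {n}) (θB {n}) y R ≡ length (select (arcB y) R)
cnt≡length y []      = refl
cnt≡length y (x ∷ R) with arcB y x
... | true  = cong suc (cnt≡length y R)
... | false = cnt≡length y R

module Values (w : SignedPerm n) (R : List (VB n)) (uR : Unique R) (R⊆ : R ⊆ Φ w) (⊆R : Φ w ⊆ R) where
  Q : PM n → PM n
  Q = inv w
  open Peeling (λs n) (arcB {n}) (θB {n})

  Gone : VB n → List (VB n)
  Gone c = select (arcB c) R

  Gone⊆Out : ∀ c → Gone c ⊆ Out c
  Gone⊆Out c {d} m = Arc⇒∈Out (arcB⇒Arc {c = c} {d} (proj₂ (∈-select⁻ (arcB c) R m)))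

  Gone-inverted : ∀ c {d} → d ∈ Gone c → invB Q d ≡ true
  Gone-inverted c {d} m = proj₂ (∈Φ⁻ w (R⊆ (proj₁ (∈-select⁻ (arcB c) R m))))

  inverted⇒Gone : ∀ c {d} → d ∈ Out c → invB Q d ≡ true → d ∈ Gone c
  inverted⇒Gone c {d} m t =
    let arc = ∈Out⇒Arc {c = c} {d} m in ∈-select (arcB c) (⊆R (∈Φ w (proj₁ (proj₂ arc)) t)) (Arc⇒arcB arc)

  value≡ : ∀ c → value R c ≡ ⌊ length (Out c) /2⌋ ∸ length (Gone c)
  value≡ c = cong (θB c ∸_) (cnt≡length c R)

  module _ {a b : PM n} (c∈Λ : InΛ (a , b)) where
    open Partners c∈Λ
    open LowerInversion Q (inv-odd w)

    partner-involutive : ∀ {d} → d ∈ Out c → partner c (partner c d) ≡ d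
    partner-involutive m with out-decomp (∈Out⇒Arc m)
    ... | k , a≺k , k≺b , inj₁ refl =
      trans (cong (partner c) (Through.partner-of-upper a≺k k≺b)) (Through.partner-of-lower a≺k k≺b)
    ... | k , a≺k , k≺b , inj₂ refl =
      trans (cong (partner c) (Through.partner-of-lower a≺k k≺b)) (Through.partner-of-upper a≺k k≺b)

    partner-closed : ∀ {d} → d ∈ Out c → partner c d ∈ Out c
    partner-closed m with out-decomp (∈Out⇒Arc m)
    ... | k , a≺k , k≺b , inj₁ refl =
      subst (_∈ Out c) (sym (Through.partner-of-upper a≺k k≺b)) (Arc⇒∈Out (Through.arc-lower a≺k k≺b))
    ... | k , a≺k , k≺b , inj₂ refl =
      subst (_∈ Out c) (sym (Through.partner-of-lower a≺k k≺b)) (Arc⇒∈Out (Through.arc-upper a≺k k≺b))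

    open Pairing (Out c) (Gone c) (partner c) partner-involutive

    -- If w⁻¹ maps no a < k < b strictly between w⁻¹(a) and w⁻¹(b), every
    -- partner pair has lost a member, so the value of c is 0.
    value-zero : (∀ k → a ≺ k → k ≺ b → Q k ≺ Q a ⊎ Q b ≺ Q k) → value R c ≡ 0
    value-zero outside = trans (value≡ c) (half-∸-zero (length (Out c)) (length (Gone c))
                                             (pairing-lower (Out-unique c) covered))
      where
      covered : ∀ {d} → d ∈ Out c → d ∈ Gone c ⊎ partner c d ∈ Gone c
      covered m with out-decomp (∈Out⇒Arc m)
      ... | k , a≺k , k≺b , inj₁ refl with outside k a≺k k≺b
      ...   | inj₁ p = inj₂ (subst (_∈ Gone c) (sym (Through.partner-of-upper a≺k k≺b))
                               (inverted⇒Gone c (Arc⇒∈Out (Through.arc-lower a≺k k≺b)) (lower-inverted p)))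
      ...   | inj₂ p = inj₁ (inverted⇒Gone c m (≺⇒<B p))
      covered m | k , a≺k , k≺b , inj₂ refl with outside k a≺k k≺b
      ...   | inj₁ p = inj₁ (inverted⇒Gone c m (lower-inverted p))
      ...   | inj₂ p = inj₂ (subst (_∈ Gone c) (sym (Through.partner-of-lower a≺k k≺b))
                               (inverted⇒Gone c (Arc⇒∈Out (Through.arc-upper a≺k k≺b)) (≺⇒<B p)))

    -- If c ∉ Φ(w) then no partner pair is fully removed; if moreover some
    -- a < k₀ < b has w⁻¹(k₀) strictly between, its pair is untouched and
    -- the value of c is positive.
    value-nonzero : Q a ≺ Q b → ∀ k₀ → a ≺ k₀ → k₀ ≺ b → Q a ≺ Q k₀ → Q k₀ ≺ Q b → value R c ≢ 0
    value-nonzero Qa≺Qb k₀ a≺k₀ k₀≺b Qa≺Qk₀ Qk₀≺Qb e =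
      half-∸-nonzero (length (Out c)) (length (Gone c)) bound (trans (sym (value≡ c)) e)
      where
      lower-gone⇒ : ∀ {k} → lower c k ∈ Gone c → Q k ≺ Q a
      lower-gone⇒ {k} m = lower-inverted⁻ {k} (Gone-inverted c m)
      upper-gone⇒ : ∀ {k} → upper c k ∈ Gone c → Q b ≺ Q k
      upper-gone⇒ {k} m = <B⇒≺ {x = Q b} {y = Q k} (Gone-inverted c m)
      both-gone : ∀ {k} → upper c k ∈ Gone c → lower c k ∈ Gone c → ⊥
      both-gone {k} mu ml =
        ≺-asym {x = Q a} {y = Q b} Qa≺Qb (≺-trans {x = Q b} {y = Q k} {z = Q a} (upper-gone⇒ mu) (lower-gone⇒ ml))
      pair-once : ∀ {d} → Σ (PM n) (λ k → a ≺ k × k ≺ b × (d ≡ upper c k ⊎ d ≡ lower c k)) →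
                  d ∈ Gone c → partner c d ∉ Gone c
      pair-once (k , a≺k , k≺b , inj₁ refl) m m' =
        both-gone m (subst (_∈ Gone c) (Through.partner-of-upper a≺k k≺b) m')
      pair-once (k , a≺k , k≺b , inj₂ refl) m m' =
        both-gone (subst (_∈ Gone c) (Through.partner-of-lower a≺k k≺b) m') m
      once : ∀ {d} → d ∈ Gone c → partner c d ∉ Gone c
      once {d} m = pair-once (out-decomp (∈Out⇒Arc {c = c} {d = d} (Gone⊆Out c m))) m
      bound : suc (suc (length (Gone c) + length (Gone c))) ≤ length (Out c)
      bound = pairing-upper (select-unique (arcB c) uR) (Gone⊆Out c) partner-closed once
                (upper c k₀) (Arc⇒∈Out (Through.arc-upper a≺k₀ k₀≺b))
                (λ m → ≺-asym {x = Q k₀} {y = Q b} Qk₀≺Qb (upper-gone⇒ m))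
                (λ m → ≺-asym {x = Q a} {y = Q k₀} Qa≺Qk₀
                         (lower-gone⇒ (subst (_∈ Gone c) (Through.partner-of-upper a≺k₀ k₀≺b) m)))
                (λ q → Through.upper≢lower a≺k₀ k₀≺b (sym (trans (sym (Through.partner-of-upper a≺k₀ k₀≺b)) q)))

-- Erasable vertices are the ascent vertices

-- an order-embedding of [±n] into ℕ, for well-founded searches
rank : PM n → ℕ
rank {n} (true  , i) = n + toℕ i
rank {n} (false , i) = n ∸ suc (toℕ i)

rank-mono : ∀ {x y : PM n} → x ≺ y → rank x < rank y
rank-mono {n} {true  , i} {true  , k} p = ℕP.+-monoʳ-< n (pos<⁻ p)
rank-mono {n} {false , i} {false , k} p = ℕP.∸-monoʳ-< (s≤s (neg<⁻ p)) (toℕ<n i)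
rank-mono {n} {false , i} {true  , k} p =
  ℕP.<-≤-trans (ℕP.∸-monoʳ-< {n = suc (toℕ i)} {o = 0} (s≤s z≤n) (toℕ<n i)) (ℕP.m≤m+n n (toℕ k))
rank-mono {n} {true  , i} {false , k} p = ⊥-elim (pos⊀neg p)

search : (P : PM n → Set) → (∀ k → Dec (P k)) → (Σ (PM n) P) ⊎ (∀ k → ¬ P k)
search {n} P P? with Any.any? P? (allPM n)
... | yes found = inj₁ (Any.satisfied found)
... | no  none  = inj₂ (λ k p → none (Any.map (λ { refl → p }) (∈-allPM k)))

Adjacent : PM n → PM n → Set
Adjacent p q = p ≺ q × (∀ z → ¬ (p ≺ z × z ≺ q))

adjacent-left : ∀ {p q r : PM n} → Adjacent p q → r ≺ q → r ≢ p → r ≺ p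
adjacent-left {p = p} {q} {r} (_ , nothing-between) r≺q r≢p with ≺-cmp r p
... | inj₁ r≺p = r≺p
... | inj₂ (inj₁ e) = ⊥-elim (r≢p e)
... | inj₂ (inj₂ p≺r) = ⊥-elim (nothing-between r (p≺r , r≺q))

adjacent-right : ∀ {p q r : PM n} → Adjacent p q → p ≺ r → r ≢ q → q ≺ r
adjacent-right {p = p} {q} {r} (_ , nothing-between) p≺r r≢q with ≺-cmp r q
... | inj₁ r≺q = ⊥-elim (nothing-between r (p≺r , r≺q))
... | inj₂ (inj₁ e) = ⊥-elim (r≢q e)
... | inj₂ (inj₂ q≺r) = q≺r

adjacent-neg : ∀ {p q : PM n} → Adjacent p q → Adjacent (neg q) (neg p)
adjacent-neg {p = p} {q} (p≺q , nothing-between) = ≺-neg p≺q , λ z (-q≺z , z≺-p) →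
  nothing-between (neg z) ( subst (_≺ neg z) (neg-involutive p) (≺-neg z≺-p)
                          , subst (neg z ≺_) (neg-involutive q) (≺-neg -q≺z))

module Erasability (w : SignedPerm n) (R : List (VB n)) (uR : Unique R) (R⊆ : R ⊆ Φ w) (⊆R : Φ w ⊆ R) where
  open Values w R uR R⊆ ⊆R
  open Peeling (λs n) (arcB {n}) (θB {n})

  private
    Q-odd : ∀ x → Q (neg x) ≡ neg (Q x)
    Q-odd = inv-odd w
    Q-injective : ∀ {a b} → Q a ≡ Q b → a ≡ b
    Q-injective = inv-injective w

    subst₂Q : ∀ {x y x' y'} → x ≡ x' → y ≡ y' → Q x ≺ Q y → Q x' ≺ Q y'
    subst₂Q refl refl p = p

  witness-neg : ∀ {y b k} → neg b ≺ k → k ≺ neg y → Q (neg b) ≺ Q k → Q k ≺ Q (neg y) →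
                y ≺ neg k × neg k ≺ b × Q y ≺ Q (neg k) × Q (neg k) ≺ Q b
  witness-neg {y} {b} {k} -b≺k k≺-y p q =
    ( subst (_≺ neg k) (neg-involutive y) (≺-neg k≺-y)
    , subst (neg k ≺_) (neg-involutive b) (≺-neg -b≺k)
    , subst₂ _≺_ (neg-involutive (Q y)) (sym (Q-odd k)) (≺-neg (subst (Q k ≺_) (Q-odd y) q))
    , subst₂ _≺_ (sym (Q-odd k)) (neg-involutive (Q b)) (≺-neg (subst (_≺ Q k) (Q-odd b) p)) )

  ascending⇒∉R : ∀ {a b} → Q a ≺ Q b → (a , b) ∉ R
  ascending⇒∉R {a} {b} p m = ≺-asym p (<B⇒≺ (proj₂ (∈Φ⁻ w (R⊆ m))))

  ∉R⇒ascending : ∀ {a b} → InΛ (a , b) → (a , b) ∉ R → Q a ≺ Q b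
  ∉R⇒ascending {a} {b} l ∉R =
    ≼∧≢⇒≺ (≮⇒≽ (<B⇒⊀ (∉Φ w l (∉R ∘ ⊆R)))) (λ e → ≺⇒≢ (proj₁ l) (Q-injective e))

  no-witness⇒value-zero : ∀ {a b} → InΛ (a , b) →
    (∀ k → a ≺ k → k ≺ b → ¬ (Q a ≺ Q k × Q k ≺ Q b)) → value R (a , b) ≡ 0
  no-witness⇒value-zero {a} {b} l none = value-zero l outside
    where
    outside : ∀ k → a ≺ k → k ≺ b → Q k ≺ Q a ⊎ Q b ≺ Q k
    outside k a≺k k≺b with ≺-cmp (Q k) (Q a)
    ... | inj₁ p = inj₁ p
    ... | inj₂ (inj₁ e) = ⊥-elim (≺⇒≢ a≺k (sym (Q-injective e)))
    ... | inj₂ (inj₂ Qa≺Qk) with ≺-cmp (Q k) (Q b)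
    ...   | inj₁ Qk≺Qb = ⊥-elim (none k a≺k k≺b (Qa≺Qk , Qk≺Qb))
    ...   | inj₂ (inj₁ e) = ⊥-elim (≺⇒≢ k≺b (Q-injective e))
    ...   | inj₂ (inj₂ p) = inj₂ p

  -- If Q a, Q b are adjacent, every remaining in-neighbour z of (a , b)
  -- has a witness strictly between, hence a positive value.
  in-neighbour-positive : ∀ {a b} → InΛ (a , b) → Adjacent (Q a) (Q b) →
    ∀ {c' d'} (z∈Λ : InΛ (c' , d')) → Q c' ≺ Q d' →
    Σ (PM n) (λ k → c' ≺ k × k ≺ d' × ((a , b) ≡ upper (c' , d') k ⊎ (a , b) ≡ lower (c' , d') k)) →
    value R (c' , d') ≢ 0
  in-neighbour-positive l adj z∈Λ Qc'≺Qd' (k , c'≺k , k≺d' , inj₁ refl) =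
    value-nonzero z∈Λ Qc'≺Qd' k c'≺k k≺d' (adjacent-left adj Qc'≺Qd' (λ e → ≺⇒≢ c'≺k (Q-injective e))) (proj₁ adj)
  in-neighbour-positive {a} {b} l adj {c'} {d'} z∈Λ Qc'≺Qd' (k , c'≺k , k≺d' , inj₂ eq)
    with toSum (c' ≟PM neg d') | InΛ? (c' , k)
  ... | inj₁ e | _ =
    -- (a , b) = (-k , d'): witness a, since -d' = c' < a = -k
    let eq' = trans eq (Partners.lower-sym z∈Λ {k} e)
        a≡-k = cong proj₁ eq' ; b≡d' = cong proj₂ eq'
    in value-nonzero z∈Λ Qc'≺Qd' a (subst (_≺ a) (sym e) (subst (neg d' ≺_) (sym a≡-k) (≺-neg k≺d')))
         (subst (a ≺_) b≡d' (proj₁ l))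
         (adjacent-left adj (subst (λ z → Q c' ≺ Q z) (sym b≡d') Qc'≺Qd')
            (λ q → ≺⇒≢ k≺d' (sym (neg-injective (trans (sym e) (trans (Q-injective q) a≡-k))))))
         (subst (λ z → Q a ≺ Q z) b≡d' (proj₁ adj))
  ... | inj₂ c'≢-d' | inj₁ lk =
    -- (a , b) = (c' , k): witness k
    let eq' = trans eq (Partners.lower-in z∈Λ c'≢-d' lk)
        a≡c' = cong proj₁ eq' ; b≡k = cong proj₂ eq'
    in value-nonzero z∈Λ Qc'≺Qd' k c'≺k k≺d' (subst₂Q a≡c' b≡k (proj₁ adj))
         (subst (λ z → Q z ≺ Q d') b≡k
           (adjacent-right adj (subst (λ z → Q z ≺ Q d') (sym a≡c') Qc'≺Qd')
             (λ q → ≺⇒≢ k≺d' (sym (trans (Q-injective q) b≡k)))))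
  ... | inj₂ c'≢-d' | inj₂ ¬lk =
    -- (a , b) = (-k , -c'): witness k, using the negated adjacency
    let eq' = trans eq (Partners.lower-out z∈Λ c'≢-d' ¬lk)
        k≡-a : k ≡ neg a
        k≡-a = trans (sym (neg-involutive k)) (cong neg (sym (cong proj₁ eq')))
        c'≡-b : c' ≡ neg b
        c'≡-b = trans (sym (neg-involutive c')) (cong neg (sym (cong proj₂ eq')))
        Q-k : Q k ≡ neg (Q a)
        Q-k = trans (cong Q k≡-a) (Q-odd a)
    in value-nonzero z∈Λ Qc'≺Qd' k c'≺k k≺d'
         (subst₂Q (sym c'≡-b) (sym k≡-a) (subst₂ _≺_ (sym (Q-odd b)) (sym (Q-odd a)) (≺-neg (proj₁ adj))))
         (subst (_≺ Q d') (sym Q-k)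
           (adjacent-right (adjacent-neg adj) (subst (_≺ Q d') (trans (cong Q c'≡-b) (Q-odd b)) Qc'≺Qd')
              (λ q → ≺⇒≢ k≺d' (sym (Q-injective (trans q (sym Q-k)))))))

  adjacent⇒erasable : ∀ {a b} → InΛ (a , b) → Adjacent (Q a) (Q b) → Erasable R (a , b)
  adjacent⇒erasable {a} {b} l adj =
    InΛ⇒∈λs l , ascending⇒∉R (proj₁ adj) ,
    no-witness⇒value-zero l (λ k _ _ (p , q) → proj₂ adj (Q k) (p , q)) ,
    λ { (c' , d') z∈ z∉R arc →
          let z∈Λ = ∈λs⇒InΛ z∈ in
          in-neighbour-positive l adj z∈Λ (∉R⇒ascending z∈Λ z∉R) (Partners.out-decomp z∈Λ (arcB⇒Arc arc)) }

  module _ {a b : PM n} (er : Erasable R (a , b)) where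
    private
      l : InΛ (a , b)
      l = ∈λs⇒InΛ (proj₁ er)
      Qa≺Qb : Q a ≺ Q b
      Qa≺Qb = ∉R⇒ascending l (proj₁ (proj₂ er))
      -- value 0 leaves no witness strictly between a and b
      no-witness : ∀ k → a ≺ k → k ≺ b → Q a ≺ Q k → Q k ≺ Q b → ⊥
      no-witness k a≺k k≺b p q = value-nonzero l Qa≺Qb k a≺k k≺b p q (proj₁ (proj₂ (proj₂ er)))
      in-neighbour : ∀ z → InΛ z → z ∉ R → Arc z (a , b) → value R z ≢ 0
      in-neighbour z z∈Λ z∉R arc = proj₂ (proj₂ (proj₂ er)) z (InΛ⇒∈λs z∈Λ) z∉R (Arc⇒arcB arc)

      -- no y > b has Q y strictly between Q a and Q b: descend to such a y
      -- admitting no witness between a and y; then (a , y) is a remaining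
      -- in-neighbour of (a , b) of value 0
      above : ∀ fuel y → rank y ≤ fuel → b ≺ y → Q a ≺ Q y → Q y ≺ Q b → ⊥
      above zero y r b≺y _ _ = ≮0 (ℕP.<-≤-trans (rank-mono b≺y) r)
      above (suc fuel) y r b≺y Qa≺Qy Qy≺Qb
        with search (λ k → a ≺ k × k ≺ y × Q a ≺ Q k × Q k ≺ Q y)
                    (λ k → (a ≺? k) ×-dec (k ≺? y) ×-dec (Q a ≺? Q k) ×-dec (Q k ≺? Q y))
      ... | inj₁ (k , a≺k , k≺y , p , q) with ≺-cmp k b
      ...   | inj₁ k≺b = no-witness k a≺k k≺b p (≺-trans q Qy≺Qb)
      ...   | inj₂ (inj₁ refl) = ≺-asym Qy≺Qb q
      ...   | inj₂ (inj₂ b≺k) = above fuel k (ℕP.≤-pred (ℕP.<-≤-trans (rank-mono k≺y) r)) b≺k p (≺-trans q Qy≺Qb)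
      above (suc fuel) y r b≺y Qa≺Qy Qy≺Qb | inj₂ none =
        in-neighbour (a , y) ay∈Λ (ascending⇒∉R Qa≺Qy) arc
          (no-witness⇒value-zero ay∈Λ (λ k a≺k k≺y (p , q) → none k (a≺k , k≺y , p , q)))
        where
        ay∈Λ : InΛ (a , y)
        ay∈Λ = ≺-trans (proj₁ l) b≺y , ≼-trans (proj₂ l) (≺⇒≼ b≺y)
        arc : Arc (a , y) (a , b)
        arc = ay∈Λ , l , (λ e → ≺⇒≢ b≺y (cong proj₂ e)) , b , proj₁ l , b≺y , inj₂ (inj₁ refl)

      below : ∀ fuel y → rank (neg y) ≤ fuel → y ≺ a → Q a ≺ Q y → Q y ≺ Q b → ⊥
      below zero y r y≺a _ _ = ≮0 (ℕP.<-≤-trans (rank-mono (≺-neg y≺a)) r)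
      below (suc fuel) y r y≺a Qa≺Qy Qy≺Qb
        with search (λ k → y ≺ k × k ≺ b × Q y ≺ Q k × Q k ≺ Q b)
                    (λ k → (y ≺? k) ×-dec (k ≺? b) ×-dec (Q y ≺? Q k) ×-dec (Q k ≺? Q b))
      ... | inj₁ (k , y≺k , k≺b , p , q) with ≺-cmp a k
      ...   | inj₁ a≺k = no-witness k a≺k k≺b (≺-trans Qa≺Qy p) q
      ...   | inj₂ (inj₁ refl) = ≺-asym Qa≺Qy p
      ...   | inj₂ (inj₂ k≺a) =
        below fuel k (ℕP.≤-pred (ℕP.<-≤-trans (rank-mono (≺-neg y≺k)) r)) k≺a (≺-trans Qa≺Qy p) q
      below (suc fuel) y r y≺a Qa≺Qy Qy≺Qb | inj₂ none with InΛ? (y , b)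
      ... | inj₁ yb∈Λ =
        in-neighbour (y , b) yb∈Λ (ascending⇒∉R Qy≺Qb) arc
          (no-witness⇒value-zero yb∈Λ (λ k y≺k k≺b (p , q) → none k (y≺k , k≺b , p , q)))
        where
        arc : Arc (y , b) (a , b)
        arc = yb∈Λ , l , (λ e → ≺⇒≢ y≺a (sym (cong proj₁ e))) , a , y≺a , proj₁ l , inj₁ refl
      ... | inj₂ ¬yb∈Λ =
        in-neighbour (neg b , neg y) z∈Λ z∉R arc (no-witness⇒value-zero z∈Λ none⁻)
        where
        y≺b : y ≺ b
        y≺b = ≺-trans y≺a (proj₁ l)
        b≺-y : b ≺ neg y
        b≺-y = ≰⇒≻ (λ q → ¬yb∈Λ (y≺b , q))
        z∈Λ : InΛ (neg b , neg y)
        z∈Λ = ≺-neg y≺b , subst (_≼ neg y) (sym (neg-involutive b)) (≺⇒≼ b≺-y)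
        z∉R : (neg b , neg y) ∉ R
        z∉R = ascending⇒∉R (subst₂ _≺_ (sym (Q-odd b)) (sym (Q-odd y)) (≺-neg Qy≺Qb))
        arc : Arc (neg b , neg y) (a , b)
        arc = z∈Λ , l , (λ e → ≺⇒≢ b≺-y (cong proj₂ e)) , neg a , ≺-neg (proj₁ l) , ≺-neg y≺a ,
              inj₂ (inj₂ (cong₂ _,_ (sym (neg-involutive a)) (sym (neg-involutive b))))
        none⁻ : ∀ k → neg b ≺ k → k ≺ neg y → ¬ (Q (neg b) ≺ Q k × Q k ≺ Q (neg y))
        none⁻ k -b≺k k≺-y (p , q) = none (neg k) (witness-neg -b≺k k≺-y p q)

    erasable⇒adjacent : InΛ (a , b) × Adjacent (Q a) (Q b)
    erasable⇒adjacent = l , Qa≺Qb , nothing-between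
      where
      nothing-between : ∀ z → ¬ (Q a ≺ z × z ≺ Q b)
      nothing-between z (p , q) =
        between (fun w z) (subst (Q a ≺_) (sym (invˡ w z)) p) (subst (_≺ Q b) (sym (invˡ w z)) q)
        where
        between : ∀ y → Q a ≺ Q y → Q y ≺ Q b → ⊥
        between y p q with ≺-cmp y a | ≺-cmp b y
        ... | inj₁ y≺a | _ = below (rank (neg y)) y ℕP.≤-refl y≺a p q
        ... | _ | inj₁ b≺y = above (rank y) y ℕP.≤-refl b≺y p q
        ... | inj₂ (inj₁ refl) | _ = ≺-irrefl p
        ... | _ | inj₂ (inj₁ refl) = ≺-irrefl q
        ... | inj₂ (inj₂ a≺y) | inj₂ (inj₂ y≺b) = no-witness y a≺y y≺b p q

adjacent⇒generator : ∀ (x y : PM n) → Adjacent x y → Σ (Fin n) λ j → Swapped j x y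
adjacent⇒generator {zero}  (_ , ()) y _
adjacent⇒generator {suc m} (false , zero)  (true , zero)  _ = zero , inj₁ (refl , refl)
adjacent⇒generator {suc m} (false , zero)  (true , suc k) (_ , nothing-between) =
  ⊥-elim (nothing-between (true , zero) (-<+ , +<+ (s≤s (s≤s z≤n))))
adjacent⇒generator {suc m} (false , zero)  (false , k) (p , _) = ⊥-elim (≮0 (neg<⁻ p))
adjacent⇒generator {suc m} (false , suc i) (true , k)  (_ , nothing-between) =
  ⊥-elim (nothing-between (false , zero) (-<- (s≤s z≤n) , -<+))
adjacent⇒generator {suc m} (false , suc i) (false , k) (p , nothing-between) with ℕP.<-cmp (toℕ k) (toℕ i)
... | tri< k<i _ _ = ⊥-elim (nothing-between (false , inject₁ i)
        ( neg< (subst (_< suc (toℕ i)) (sym (toℕ-inject₁ i)) (ℕP.n<1+n _))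
        , neg< (subst (toℕ k <_) (sym (toℕ-inject₁ i)) k<i)))
... | tri≈ _ k≡i _ = suc i , inj₂ (refl , cong (false ,_) (toℕ-injective (trans k≡i (sym (toℕ-inject₁ i)))))
... | tri> _ _ i<k = ⊥-elim (ℕP.<-irrefl refl (ℕP.<-≤-trans i<k (ℕP.≤-pred (neg<⁻ p))))
adjacent⇒generator {suc m} (true , i) (false , k) (p , _) = ⊥-elim (pos⊀neg p)
adjacent⇒generator {suc m} (true , i) (true , zero) (p , _) = ⊥-elim (≮0 (pos<⁻ p))
adjacent⇒generator {suc m} (true , i) (true , suc k) (p , nothing-between) with ℕP.<-cmp (toℕ i) (toℕ k)
... | tri< i<k _ _ = ⊥-elim (nothing-between (true , inject₁ k)
        ( pos< (subst (toℕ i <_) (sym (toℕ-inject₁ k)) i<k)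
        , pos< (subst (_< suc (toℕ k)) (sym (toℕ-inject₁ k)) (ℕP.n<1+n _))))
... | tri≈ _ i≡k _ = suc k , inj₁ (cong (true ,_) (toℕ-injective (trans i≡k (sym (toℕ-inject₁ k)))) , refl)
... | tri> _ _ k<i = ⊥-elim (ℕP.<-irrefl refl (ℕP.<-≤-trans k<i (ℕP.≤-pred (pos<⁻ p))))

module AscentVertices (w : SignedPerm n) where
  Q : PM n → PM n
  Q = inv w

  adjacent⇒E : ∀ {a b} → InΛ (a , b) → Adjacent (Q a) (Q b) →
               Σ (Fin n) λ j → (a , b) ≡ E w j × invB Q (E w j) ≡ false
  adjacent⇒E {a} {b} l adj with adjacent⇒generator (Q a) (Q b) adj
  ... | j , inj₁ (e₁ , e₂) = j , eq , subst (λ c → invB Q c ≡ false) eq (invB-false {P = Q} (proj₁ adj))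
    where eq : (a , b) ≡ E w j
          eq = vertexOf-unique (x₀≢y₀ w j) l (inj₁ (cong₂ _,_ (P⁻¹ w j e₁) (P⁻¹ w j e₂)))
  ... | j , inj₂ (e₁ , e₂) = j , eq , subst (λ c → invB Q c ≡ false) eq (invB-false {P = Q} (proj₁ adj))
    where eq : (a , b) ≡ E w j
          eq = vertexOf-unique (x₀≢y₀ w j) l (inj₂ (inj₂ (inj₁ (cong₂ _,_ (P⁻¹-neg w j e₁) (P⁻¹-neg w j e₂)))))

  E-adjacent : ∀ j → invB Q (E w j) ≡ false → Adjacent (Q (proj₁ (E w j))) (Q (proj₂ (E w j)))
  E-adjacent j asc with proj₂ (E-spec w j)
  ... | inj₁ e rewrite e | P-x₀ w j | P-y₀ w j = eP≺fP j , eP-fP-adjacent j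
  ... | inj₂ (inj₁ e) rewrite e | P-x₀ w j | P-y₀ w j =
    ⊥-elim (true≢false (trans (sym (invB-true {P = id} (eP≺fP j))) asc))
  ... | inj₂ (inj₂ (inj₁ e)) rewrite e | P-neg-x₀ w j | P-neg-y₀ w j = adjacent-neg (eP≺fP j , eP-fP-adjacent j)
  ... | inj₂ (inj₂ (inj₂ e)) rewrite e | P-neg-x₀ w j | P-neg-y₀ w j =
    ⊥-elim (true≢false (trans (sym (invB-true {P = id} (≺-neg (eP≺fP j)))) asc))

-- Peeling sequences are the inversion sequences of reduced words

private
  take-∷ʳ : ∀ (R : List A) x k → take k (R ∷ʳ x) ≡ take k R ⊎ take k (R ∷ʳ x) ≡ R ∷ʳ x
  take-∷ʳ R x zero = inj₁ refl
  take-∷ʳ [] x (suc zero) = inj₂ refl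
  take-∷ʳ [] x (suc (suc k)) = inj₂ refl
  take-∷ʳ (y ∷ R) x (suc k) with take-∷ʳ R x k
  ... | inj₁ e = inj₁ (cong (y ∷_) e)
  ... | inj₂ e = inj₂ (cong (y ∷_) e)

  take-length-++ : ∀ (xs ys : List A) → take (length xs) (xs ++ ys) ≡ xs
  take-length-++ [] ys = refl
  take-length-++ (x ∷ xs) ys = cong (x ∷_) (take-length-++ xs ys)

module PeelingB (n : ℕ) where
  open Peeling (λs n) (arcB {n}) (θB {n})

  peel-unique : ∀ {R} → Peel R → Unique R
  peel-unique done = []
  peel-unique (step {R} p (_ , x∉R , _)) = unique-∷ʳ R x∉R (peel-unique p)

  IsΦ : List (VB n) → SignedPerm n → Set
  IsΦ R w = R ⊆ Φ w × Φ w ⊆ R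

  peel-ascent : ∀ (w : SignedPerm n) j {R} → Peel R → IsΦ R w → invB (inv w) (E w j) ≡ false →
                Peel (R ∷ʳ E w j) × IsΦ (R ∷ʳ E w j) (w ·s j) × length (Φ (w ·s j)) ≡ suc (length (Φ w))
  peel-ascent w j {R} p (R⊆ , ⊆R) asc with FlipStep.flip-step w j
  ... | inj₂ down = ⊥-elim (true≢false (trans (sym (proj₁ down)) asc))
  ... | inj₁ (_ , _ , E∈ , length-up , grows , new) = step p erasable , (⊆new , new⊆) , length-up
    where
    erasable : Erasable R (E w j)
    erasable = Erasability.adjacent⇒erasable w R (peel-unique p) R⊆ ⊆R
                 (E-InΛ w j) (AscentVertices.E-adjacent w j asc)
    ⊆new : (R ∷ʳ E w j) ⊆ Φ (w ·s j)
    ⊆new m with ∈-++⁻ R m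
    ... | inj₁ m' = grows (R⊆ m')
    ... | inj₂ (here refl) = E∈
    new⊆ : Φ (w ·s j) ⊆ (R ∷ʳ E w j)
    new⊆ m with new m
    ... | inj₁ m' = ∈-++⁺ˡ (⊆R m')
    ... | inj₂ refl = ∈-++⁺ʳ R (here refl)

  erasable⇒ascent : ∀ (w : SignedPerm n) {R} → Peel R → IsΦ R w → ∀ {x} → Erasable R x →
                    Σ (Fin n) λ j → x ≡ E w j × invB (inv w) (E w j) ≡ false
  erasable⇒ascent w p (R⊆ , ⊆R) er =
    let (l , adj) = Erasability.erasable⇒adjacent w _ (peel-unique p) R⊆ ⊆R er
    in AscentVertices.adjacent⇒E w l adj

  peel⇒Φ : ∀ {R} → Peel R → Σ (SignedPerm n) (IsΦ R)
  peel⇒Φ done = idP , (λ ()) , (λ m → ⊥-elim (∉[] (subst (_ ∈_) (Φ-id {n}) m)))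
  peel⇒Φ (step {R} p er) =
    let (w , isΦ) = peel⇒Φ p
        (j , x≡E , asc) = erasable⇒ascent w p isΦ er
        (_ , (⊆new , new⊆) , _) = peel-ascent w j p isΦ asc
    in w ·s j , subst (λ x → (R ∷ʳ x) ⊆ Φ (w ·s j)) (sym x≡E) ⊆new
              , subst (λ x → Φ (w ·s j) ⊆ (R ∷ʳ x)) (sym x≡E) new⊆

  peel-prefix : ∀ {xs} → Peel xs → ∀ k → Peel (take k xs)
  peel-prefix done k = subst Peel (sym (ListP.take-[] k)) done
  peel-prefix (step {R} {x} p er) k with take-∷ʳ R x k
  ... | inj₁ e = subst Peel (sym e) (peel-prefix p k)
  ... | inj₂ e = subst Peel (sym e) (step p er)

  -- from state Φ(w), keep peeling ascent vertices until none is erasable;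
  -- fuel bounds the number of steps since |Φ| ≤ |λ_n^s|
  extend-to-complete : ∀ fuel (w : SignedPerm n) xs → Peel xs → IsΦ xs w →
                       length (λs n) ≤ fuel + length (Φ w) → Σ (List (VB n)) λ ys → Complete (xs ++ ys)
  extend-to-complete fuel w xs p isΦ bound with any? (λ j → invB (inv w) (E w j) BoolP.≟ false)
  ... | no none = [] , subst Complete (sym (ListP.++-identityʳ xs))
                         (p , λ x er → let (j , _ , asc) = erasable⇒ascent w p isΦ er in none (j , asc))
  ... | yes (j , asc) with peel-ascent w j p isΦ asc | fuel
  ...   | (_ , _ , length-up) | zero =
    ⊥-elim (ℕP.<-irrefl refl (ℕP.<-≤-trans (subst (_≤ length (λs n)) length-up Φ≤λ) bound))
    where Φ≤λ : length (Φ (w ·s j)) ≤ length (λs n)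
          Φ≤λ = unique-⊆-length (Φ-unique (w ·s j)) (λ m → proj₁ (∈-select⁻ (invB (inv (w ·s j))) (λs n) m))
  ...   | (p' , isΦ' , length-up) | suc fuel' =
    let (ys , complete) = extend-to-complete fuel' (w ·s j) (xs ∷ʳ E w j) p' isΦ'
                            (subst (length (λs n) ≤_)
                                   (trans (sym (ℕP.+-suc fuel' _)) (cong (fuel' +_) (sym length-up))) bound)
    in (E w j ∷ ys) , subst Complete (ListP.++-assoc xs (E w j ∷ []) ys) complete

  -- Φ(w) is listed by a peeling sequence: peel along a reduced word
  Φ-peel : ∀ k (w : SignedPerm n) → length (Φ w) ≡ k → Σ (List (VB n)) λ xs → Peel xs × IsΦ xs w
  Φ-peel zero w e = [] , done , (λ ()) , (λ m → ⊥-elim (ℕP.0≢1+n (trans (sym e) (length-remove (Φ w) m))))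
  Φ-peel (suc k) w e with descent-exists w (λ e' → ℕP.0≢1+n (trans (sym e') e))
  ... | j , desc with FlipStep.flip-step w j
  ...   | inj₁ up = ⊥-elim (true≢false (trans (sym desc) (proj₁ up)))
  ...   | inj₂ (_ , _ , _ , length-down , _) with Φ-peel k (w ·s j) (ℕP.suc-injective (trans (sym length-down) e))
  ...     | xs , p , isΦ with FlipStep.flip-step (w ·s j) j
  ...       | inj₂ (_ , _ , _ , length-down' , _) =
    -- s_j cannot be a descent of w s_j as well: |Φ(w)| would be |Φ(w)| + 2
    ⊥-elim (ℕP.<-irrefl (trans length-down (cong suc (trans length-down' (cong (suc ∘ length) (Φ-·s-·s w j)))))
                        (ℕP.<-trans (ℕP.n<1+n _) (ℕP.n<1+n _)))
  ...       | inj₁ (asc' , _) =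
    let (p' , isΦ' , _) = peel-ascent (w ·s j) j p isΦ asc'
    in (xs ∷ʳ E (w ·s j) j) , p' ,
       subst (λ z → (xs ∷ʳ E (w ·s j) j) ⊆ z) (Φ-·s-·s w j) (proj₁ isΦ') ,
       subst (_⊆ (xs ∷ʳ E (w ·s j) j)) (Φ-·s-·s w j) (proj₂ isΦ')

  Φ∈IS : ∀ (w : SignedPerm n) → InIS (Φ w)
  Φ∈IS w with Φ-peel (length (Φ w)) w refl
  ... | [] , _ , _ , ⊆[] = inj₁ (λ x m → ∉[] (⊆[] m))
  ... | xs@(_ ∷ _) , p , (xs⊆ , ⊆xs) =
    let (ys , complete) = extend-to-complete (length (λs n)) w xs p (xs⊆ , ⊆xs)
                            (ℕP.m≤m+n (length (λs n)) (length (Φ w)))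
        prefix = take-length-++ xs ys
    in inj₂ ( xs ++ ys , length xs , complete , s≤s z≤n , ListP.length-++-≤ˡ xs
            , subst (Φ w ⊆_) (sym prefix) ⊆xs , subst (_⊆ Φ w) (sym prefix) xs⊆ )

  IS⇒Φ : ∀ X → InIS X → Σ (SignedPerm n) λ w → Φ w ≋ X
  IS⇒Φ X (inj₁ empty) = idP , (λ m → ⊥-elim (∉[] (subst (_ ∈_) (Φ-id {n}) m))) , (λ m → ⊥-elim (empty _ m))
  IS⇒Φ X (inj₂ (xs , k , (p , _) , _ , _ , (X⊆ , ⊆X))) =
    let (w , (prefix⊆ , ⊆prefix)) = peel⇒Φ (peel-prefix p k) in w , (⊆X ∘ ⊆prefix) , (prefix⊆ ∘ X⊆)

theorem5 : (n : ℕ) → 1 ≤ n →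
    Σ (SignedPerm n → List (VB n)) λ Φ →
      (∀ w → 𝓑.InIS n (Φ w))
      × (∀ w τ → w ≈B τ → 𝓑._≋_ n (Φ w) (Φ τ))
      × (∀ w τ → 𝓑._≋_ n (Φ w) (Φ τ) → w ≈B τ)
      × (∀ X → 𝓑.InIS n X → Σ (SignedPerm n) λ w → 𝓑._≋_ n (Φ w) X)
      × (∀ w τ → (w ≤R τ) ⇔ (Φ w ⊆ Φ τ))
theorem5 n _ =
  Φ ,
  PeelingB.Φ∈IS n ,
  (λ w τ w≈τ → let e = Φ-cong w τ w≈τ in subst (Φ w ⊆_) e id , subst (_⊆ Φ w) e id) ,
  (λ w τ (Φw⊆Φτ , Φτ⊆Φw) → Φ-determines w τ Φw⊆Φτ (λ j E∉ E∈ → E∉ (Φτ⊆Φw E∈))) ,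
  PeelingB.IS⇒Φ n ,
  (λ w τ → mk⇔ (≤R⇒⊆ w τ) (⊆⇒≤R w τ))
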